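{- Let $n\ge 1$ and $N\ge M\ge 1$ be integers and let $A=\{\mathbf a_1,\dots,\mathbf a_N\}\subseteq\mathbb Z^n$, where each $\mathbf a_j=(a_{1j},\dots,a_{nj})$ has last coordinate $a_{nj}=1$. Put $\beta=\sum_{j=1}^M\mathbf a_j$, suppose $A'=\{\mathbf a_1,\dots,\mathbf a_M\}$ is minimal for $\sigma_\beta^\circ$, and let $u=(u_1,\dots,u_n)\in\mathcal M_\beta$. Then $F_u(\Lambda)$ satisfies the $A$-hypergeometric system with parameter $u$, i.e. it is annihilated by every box operator $\Box_l$, $l\in L$, and by every Euler operator $Z_i$, $i=1,\dots,n$.
   Context: $\mathbb N$ denotes the nonnegative integers. $C(A)$ is the real cone generated by $A$; $\sigma_\beta$ is the smallest closed face of $C(A)$ containing $\beta$, $\sigma_\beta^\circ$ its relative interior. $A'$ is minimal for $\sigma_\beta^\circ$ if for every proper subset $J\subsetneq\{1,\dots,M\}$, $\sum_{j\in J}\mathbf a_j\notin\sigma_\beta^\circ$. $\mathbb ZA$ is the subgroup of $\mathbb Z^n$ generated by $A$, $\mathcal M_\beta=(-\sigma_\beta^\circ)\cap\mathbb ZA$, $E_\beta=\{l\in\mathbb N^N: l_j=0\text{ whenever }\mathbf a_j\notin\sigma_\beta\}$, and for $u\in\mathcal M_\beta$ \[F_u(\Lambda)=\sum_{\substack{l\in E_\beta\\ \sum_{j=1}^M(-l_j-1)\mathbf a_j+\sum_{j=M+1}^N l_j\mathbf a_j=u}}(-1)^{\sum_{j=1}^M l_j}\frac{\prod_{j=1}^M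 l_j!}{\prod_{j=M+1}^N l_j!}\,\Lambda_1^{ -l_1-1}\cdots\Lambda_M^{ -l_M-1}\Lambda_{M+1}^{l_{M+1}}\cdots\Lambda_N^{l_N}.\] $L=\{l\in\mathbb Z^N:\sum_{j=1}^N l_j\mathbf a_j=0\}$. For $l\in L$, $\Box_l=\prod_{l_j>0}(\partial/\partial\Lambda_j)^{l_j}-\prod_{l_j<0}(\partial/\partial\Lambda_j)^{ -l_j}$. The Euler operators with parameter $u$ are $Z_i=\sum_{j=1}^N a_{ij}\Lambda_j\,\partial/\partial\Lambda_j-u_i$, $i=1,\dots,n$. Operators act on formal Laurent series term by term.
   Formalization: The cone C(A), its face σ_β, the relative interior σ_β° and the affine hulls used for it are taken in ℚ^n rather than in ℝ^n. -}

module Defs where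

open import Data.Bool using (Bool; true; false; if_then_else_)
open import Data.Nat as ℕ using (ℕ; zero; suc; _!)
open import Data.Nat.Properties using (_!≢0; m*n≢0)
open import Data.Integer as ℤ using (ℤ; +_; -[1+_])
open import Data.Rational as ℚ using (ℚ; 0ℚ; 1ℚ; _/_; ∣_∣)
open import Data.Fin using (Fin; zero; suc; splitAt; _↑ˡ_; _↑ʳ_)
open import Data.Fin.Subset using (Subset)
open import Data.Vec using (lookup)
open import Data.List using (List; []; _∷_; foldr; allFin)
open import Data.List.Relation.Unary.All using (All)
open import Data.Sum using (inj₁; inj₂)
open import Data.Product using (Σ; ∃; _×_; _,_; proj₁; proj₂)
open import Relation.Nullary using (¬_)
open import Relation.Binary.PropositionalEquality using (_≡_)

Σℚ : ∀ {k} → (Fin k → ℚ) → ℚ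
Σℚ {zero}  f = 0ℚ
Σℚ {suc k} f = f zero ℚ.+ Σℚ (λ j → f (suc j))

Σℤ : ∀ {k} → (Fin k → ℤ) → ℤ
Σℤ {zero}  f = + 0
Σℤ {suc k} f = f zero ℤ.+ Σℤ (λ j → f (suc j))

Σℕ : ∀ {k} → (Fin k → ℕ) → ℕ
Σℕ {zero}  f = 0
Σℕ {suc k} f = f zero ℕ.+ Σℕ (λ j → f (suc j))

Πfact : ∀ {k} → (Fin k → ℕ) → ℕ
Πfact {zero}  f = 1
Πfact {suc k} f = (f zero) ! ℕ.* Πfact (λ j → f (suc j))

Πfact≢0 : ∀ {k} (f : Fin k → ℕ) → ℕ.NonZero (Πfact f)
Πfact≢0 {zero}  f = _
Πfact≢0 {suc k} f =
  m*n≢0 ((f zero) !) (Πfact (λ j → f (suc j)))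
    {{(f zero) !≢0}} {{Πfact≢0 (λ j → f (suc j))}}

toℚ : ℤ → ℚ
toℚ z = z / 1

-- The configuration A = {a_1,…,a_N} with N = M + K is a family
-- A : Fin (M + K) → Fin n → ℤ ; A j i = a_{ij}.  The first M columns
-- (indices j ↑ˡ K) are a_1,…,a_M, the last K are a_{M+1},…,a_N.

Point : ℕ → Set
Point n = Fin n → ℚ

Lat : ℕ → Set
Lat n = Fin n → ℤ

embed : ∀ {n} → Lat n → Point n
embed x i = toℚ (x i)

_·_ : ∀ {n} → Point n → Point n → ℚ
x · y = Σℚ (λ i → x i ℚ.* y i)

module _ {n : ℕ} (M K : ℕ) (A : Fin (M ℕ.+ K) → Lat n) where

  InCone : Point n → Set
  InCone x = Σ (Fin (M ℕ.+ K) → ℚ) λ c →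
               (∀ j → 0ℚ ℚ.≤ c j) ×
               (∀ i → x i ≡ Σℚ (λ j → c j ℚ.* toℚ (A j i)))

  -- w defines a supporting hyperplane: w·x ≥ 0 on C(A).
  -- The faces of C(A) are exactly the sets C(A) ∩ {x | w·x = 0}.
  Supporting : Point n → Set
  Supporting w = ∀ x → InCone x → 0ℚ ℚ.≤ (w · x)

  -- σ_β : the smallest face of C(A) containing β, i.e. the
  -- intersection of all faces C(A) ∩ w^⊥ containing β.
  InFaceOf : Point n → Point n → Set
  InFaceOf β x = InCone x ×
    (∀ w → Supporting w → (w · β) ≡ 0ℚ → (w · x) ≡ 0ℚ)

  InAffHull : (Point n → Set) → Point n → Set
  InAffHull S x = Σ (List (ℚ × Point n)) λ cs →
      All (λ c → S (proj₂ c)) cs ×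
      (foldr (λ c s → proj₁ c ℚ.+ s) 0ℚ cs ≡ 1ℚ) ×
      (∀ i → x i ≡ foldr (λ c s → (proj₁ c ℚ.* proj₂ c i) ℚ.+ s) 0ℚ cs)

  InRelInt : (Point n → Set) → Point n → Set
  InRelInt S x = S x × Σ ℚ λ ε → (0ℚ ℚ.< ε) ×
    (∀ y → InAffHull S y → (∀ i → ∣ y i ℚ.- x i ∣ ℚ.< ε) → S y)

  β : Lat n
  β i = Σℤ (λ k → A (k ↑ˡ K) i)

  σβ : Point n → Set
  σβ = InFaceOf (embed β)

  subsetSum : Subset M → Lat n
  subsetSum J i = Σℤ (λ k → if lookup J k then A (k ↑ˡ K) i else + 0)

  MinimalFor : Set
  MinimalFor = ∀ (J : Subset M) → ¬ (J ≡ Data.Fin.Subset.⊤) →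
               ¬ InRelInt σβ (embed (subsetSum J))

  InZA : Lat n → Set
  InZA u = Σ (Fin (M ℕ.+ K) → ℤ) λ c →
             ∀ i → u i ≡ Σℤ (λ j → c j ℤ.* A j i)

  InMβ : Lat n → Set
  InMβ u = InRelInt σβ (embed (λ i → ℤ.- u i)) × InZA u

  InE : (Fin (M ℕ.+ K) → ℕ) → Set
  InE l = ∀ j → ¬ σβ (embed (A j)) → l j ≡ 0

  -- exponent of Λ_j in the monomial indexed by l
  expo : (Fin (M ℕ.+ K) → ℕ) → Fin (M ℕ.+ K) → ℤ
  expo l j with splitAt M j
  ... | inj₁ _ = -[1+ l j ]
  ... | inj₂ _ = + l j

  SumCond : Lat n → (Fin (M ℕ.+ K) → ℕ) → Set
  SumCond u l = ∀ i → Σℤ (λ j → expo l j ℤ.* A j i) ≡ u i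

  coef : (Fin (M ℕ.+ K) → ℕ) → ℚ
  coef l = ((ℤ.- (+ 1)) ℤ.^ Σℕ (λ k → l (k ↑ˡ K)) ℤ.* + Πfact (λ k → l (k ↑ˡ K)))
           / Πfact (λ k → l (M ↑ʳ k))
           where instance _ = Πfact≢0 (λ k → l (M ↑ʳ k))

-- Formal Laurent series in Λ_1,…,Λ_N with ℚ coefficients:
-- F e = coefficient of Λ^e.  Operators act term by term.

Series : ℕ → Set
Series N = (Fin N → ℤ) → ℚ

module _ {N : ℕ} where

  δ : Fin N → Fin N → ℤ
  δ j k with j Data.Fin.≟ k
  ... | Relation.Nullary.yes _ = + 1
  ... | Relation.Nullary.no  _ = + 0

  ∂ : Fin N → Series N → Series N
  ∂ j F e = toℚ (e j ℤ.+ + 1) ℚ.* F (λ k → e k ℤ.+ δ j k)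

  mulΛ : Fin N → Series N → Series N
  mulΛ j F e = F (λ k → e k ℤ.- δ j k)

  ∂^ : Fin N → ℕ → Series N → Series N
  ∂^ j zero    F = F
  ∂^ j (suc m) F = ∂ j (∂^ j m F)

  ∂multi : (Fin N → ℕ) → Series N → Series N
  ∂multi k F = foldr (λ j G → ∂^ j (k j) G) F (allFin N)

  posPart : ℤ → ℕ
  posPart (+ m)    = m
  posPart -[1+ m ] = 0

  negPart : ℤ → ℕ
  negPart (+ m)    = 0
  negPart -[1+ m ] = suc m

  box : (Fin N → ℤ) → Series N → Series N
  box l F e = ∂multi (λ j → posPart (l j)) F e ℚ.- ∂multi (λ j → negPart (l j)) F e

Annihilates : ∀ {N} → (Series N → Series N) → Series N → Set
Annihilates P F = ∀ e → P F e ≡ 0ℚ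

module _ {n : ℕ} (M K : ℕ) (A : Fin (M ℕ.+ K) → Lat n) where

  InL : (Fin (M ℕ.+ K) → ℤ) → Set
  InL l = ∀ i → Σℤ (λ j → l j ℤ.* A j i) ≡ + 0

  euler : Lat n → Fin n → Series (M ℕ.+ K) → Series (M ℕ.+ K)
  euler u i F e = Σℚ (λ j → toℚ (A j i) ℚ.* mulΛ j (∂ j F) e) ℚ.- toℚ (u i) ℚ.* F e

  -- F is the series F_u(Λ): its coefficient at Λ^e is the l-th summand when
  -- e is the exponent of an admissible l, and 0 otherwise
  -- (distinct l give distinct monomials).
  IsFu : Lat n → Series (M ℕ.+ K) → Set
  IsFu u F = ∀ e →
    (∀ l → InE M K A l → (∀ j → expo M K A l j ≡ e j) → SumCond M K A u l → F e ≡ coef M K A l) ×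
    (¬ (Σ (Fin (M ℕ.+ K) → ℕ) λ l → InE M K A l × (∀ j → expo M K A l j ≡ e j) × SumCond M K A u l)
       → F e ≡ 0ℚ)

-- By definition the exponents of F_u are the vectors expo l with l ∈ E_β and Σ_j (expo l)_j a_j = u.
-- Conversely every integer solution y of Σ_j y_j a_j = u with y_j ≥ 0 for j > M is such an exponent:
-- as −u ∈ σ_β, a supporting functional vanishing on β vanishes on every a_j with y_j ≠ 0, and
-- minimality of A′ forces y_j < 0 for all j ≤ M (otherwise the vertex sum over the proper subset
-- J = {j ≤ M : y_j < 0} would be a small multiple of −u ∈ σ_β° plus a nonnegative combination of
-- generators in σ_β, hence in σ_β°). Consequently ∂^q F_u has at Λ^x the coefficient of the monomial
-- Λ^x when x + q solves the linear system and x_j ≥ 0 for j > M, and 0 otherwise. For l ∈ L the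
-- vectors x + l⁺ and x + l⁻ solve the system simultaneously, so □_l F_u = 0; and Z_i multiplies the
-- coefficient of Λ^e by Σ_j a_ij e_j − u_i, which vanishes on the support.
module Submission where

open import Defs
open import Data.Nat using (ℕ; suc; _+_; _≤_)
open import Data.Integer using (ℤ; +_)
open import Data.Fin using (Fin; fromℕ)
open import Data.Product using (_×_)
open import Relation.Binary.PropositionalEquality using (_≡_)

open import Algebra.Bundles using (CommutativeSemiring; CommutativeRing)
open import Data.Bool using (true; false; if_then_else_)
open import Data.Fin as Fin using (zero; suc; _↑ˡ_; _↑ʳ_; splitAt; join)
open import Data.Fin.Properties
  using (splitAt-↑ˡ; splitAt-↑ʳ; join-splitAt; suc-injective; ↑ˡ-injective; ↑ʳ-injective)
open import Data.Fin.Subset as Subset using (Subset)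
open import Data.Integer as ℤ using (-[1+_])
import Data.Integer.Properties as ℤP
import Data.Integer.Solver as ℤSolver
open import Data.List as List using (List; []; _∷_; foldr; map)
open import Data.List.Relation.Unary.All using ([]; _∷_)
import Data.List.Relation.Unary.All.Properties as All
open import Data.Nat as ℕ using (zero; _!)
import Data.Nat.Properties as ℕP
open import Data.Product using (Σ; _,_; proj₁; proj₂)
open import Data.Rational as ℚ using (ℚ; 0ℚ; 1ℚ)
import Data.Rational.Properties as ℚP
import Data.Rational.Solver as ℚSolver
open import Data.Rational.Unnormalised as ℚᵘ using (mkℚᵘ; *≡*; *≤*; *<*)
import Data.Rational.Unnormalised.Properties as ℚᵘP
open import Data.Sum using (_⊎_; inj₁; inj₂; [_,_])
open import Data.Vec using (lookup; tabulate)
import Data.Vec.Properties as Vec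
open import Function using (_∘_)
open import Level using (0ℓ)
open import Relation.Binary.PropositionalEquality
  using (refl; sym; trans; cong; cong₂; subst; subst₂; _≗_; _≢_; module ≡-Reasoning)
open import Relation.Nullary using (¬_; yes; no; contradiction)
open import Relation.Nullary.Decidable using (decidable-stable; does; dec-false)

module _ {M K : ℕ} where

  elimᴹᴷ : ∀ {p} {P : Fin (M + K) → Set p} →
           (∀ k → P (k ↑ˡ K)) → (∀ k → P (M ↑ʳ k)) → ∀ j → P j
  elimᴹᴷ {P = P} f g j = subst P (join-splitAt M K j) ([_,_] {C = P ∘ join M K} f g (splitAt M j))

↑ˡ≢↑ʳ : ∀ {M K} (k : Fin M) (k′ : Fin K) → k ↑ˡ K ≢ M ↑ʳ k′
↑ˡ≢↑ʳ {M} {K} k k′ eq with () ← trans (sym (splitAt-↑ˡ M k K)) (trans (cong (splitAt M) eq) (splitAt-↑ʳ M K k′))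

module FinSum {c ℓ} (R : CommutativeSemiring c ℓ)
  (∑ : ∀ {k} → (Fin k → CommutativeSemiring.Carrier R) → CommutativeSemiring.Carrier R)
  (∑-zero : ∀ f → CommutativeSemiring._≈_ R (∑ {0} f) (CommutativeSemiring.0# R))
  (∑-suc : ∀ {k} f → CommutativeSemiring._≈_ R (∑ {suc k} f) (CommutativeSemiring._+_ R (f zero) (∑ (f ∘ suc))))
  where

  open CommutativeSemiring R using (Carrier; _≈_; 0#) renaming (_+_ to _⊕_)

  open CommutativeSemiring R
    using (setoid; +-cong; *-cong; +-assoc; +-identityˡ; +-identityʳ; distribˡ; zeroʳ
          ; +-commutativeSemigroup)
    renaming (_*_ to _⊗_; refl to ≈-refl; sym to ≈-sym; trans to ≈-trans)
  open import Relation.Binary.Reasoning.Setoid setoid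
  open import Algebra.Properties.CommutativeSemigroup +-commutativeSemigroup
    using (interchange; x∙yz≈y∙xz)

  ∑-cong : ∀ {k} {f g : Fin k → Carrier} → (∀ j → f j ≈ g j) → ∑ f ≈ ∑ g
  ∑-cong {zero}  {f} {g} f≈g = ≈-trans (∑-zero f) (≈-sym (∑-zero g))
  ∑-cong {suc k} {f} {g} f≈g = begin
    ∑ f                   ≈⟨ ∑-suc f ⟩
    f zero ⊕ ∑ (f ∘ suc)  ≈⟨ +-cong (f≈g zero) (∑-cong (f≈g ∘ suc)) ⟩
    g zero ⊕ ∑ (g ∘ suc)  ≈⟨ ∑-suc g ⟨
    ∑ g                   ∎

  ∑-zeros : ∀ {k} {f : Fin k → Carrier} → (∀ j → f j ≈ 0#) → ∑ f ≈ 0#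
  ∑-zeros {zero}  {f} f≈0 = ∑-zero f
  ∑-zeros {suc k} {f} f≈0 = begin
    ∑ f                   ≈⟨ ∑-suc f ⟩
    f zero ⊕ ∑ (f ∘ suc)  ≈⟨ +-cong (f≈0 zero) (∑-zeros (f≈0 ∘ suc)) ⟩
    0# ⊕ 0#               ≈⟨ +-identityˡ 0# ⟩
    0#                    ∎

  ∑-distrib-+ : ∀ {k} (f g : Fin k → Carrier) → ∑ (λ j → f j ⊕ g j) ≈ ∑ f ⊕ ∑ g
  ∑-distrib-+ {zero} f g = begin
    ∑ (λ j → f j ⊕ g j)  ≈⟨ ∑-zero _ ⟩
    0#                   ≈⟨ +-identityˡ 0# ⟨
    0# ⊕ 0#              ≈⟨ +-cong (∑-zero f) (∑-zero g) ⟨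
    ∑ f ⊕ ∑ g            ∎
  ∑-distrib-+ {suc k} f g = begin
    ∑ (λ j → f j ⊕ g j)                                ≈⟨ ∑-suc _ ⟩
    (f zero ⊕ g zero) ⊕ ∑ (λ j → f (suc j) ⊕ g (suc j)) ≈⟨ +-cong ≈-refl (∑-distrib-+ (f ∘ suc) (g ∘ suc)) ⟩
    (f zero ⊕ g zero) ⊕ (∑ (f ∘ suc) ⊕ ∑ (g ∘ suc))     ≈⟨ interchange _ _ _ _ ⟩
    (f zero ⊕ ∑ (f ∘ suc)) ⊕ (g zero ⊕ ∑ (g ∘ suc))     ≈⟨ +-cong (∑-suc f) (∑-suc g) ⟨
    ∑ f ⊕ ∑ g                                          ∎

  ∑-distribˡ-* : ∀ {k} (x : Carrier) (f : Fin k → Carrier) → ∑ (λ j → x ⊗ f j) ≈ x ⊗ ∑ f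
  ∑-distribˡ-* {zero} x f = begin
    ∑ (λ j → x ⊗ f j)  ≈⟨ ∑-zero _ ⟩
    0#                 ≈⟨ zeroʳ x ⟨
    x ⊗ 0#             ≈⟨ *-cong ≈-refl (∑-zero f) ⟨
    x ⊗ ∑ f            ∎
  ∑-distribˡ-* {suc k} x f = begin
    ∑ (λ j → x ⊗ f j)                 ≈⟨ ∑-suc _ ⟩
    x ⊗ f zero ⊕ ∑ (λ j → x ⊗ f (suc j)) ≈⟨ +-cong ≈-refl (∑-distribˡ-* x (f ∘ suc)) ⟩
    x ⊗ f zero ⊕ x ⊗ ∑ (f ∘ suc)       ≈⟨ distribˡ x _ _ ⟨
    x ⊗ (f zero ⊕ ∑ (f ∘ suc))         ≈⟨ *-cong ≈-refl (∑-suc f) ⟨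
    x ⊗ ∑ f                            ∎

  ∑-comm : ∀ {k m} (f : Fin k → Fin m → Carrier) →
           ∑ (λ i → ∑ (λ j → f i j)) ≈ ∑ (λ j → ∑ (λ i → f i j))
  ∑-comm {zero} f = begin
    ∑ (λ i → ∑ (f i))          ≈⟨ ∑-zero _ ⟩
    0#                         ≈⟨ ∑-zeros (λ j → ∑-zero _) ⟨
    ∑ (λ j → ∑ (λ i → f i j))  ∎
  ∑-comm {suc k} f = begin
    ∑ (λ i → ∑ (f i))                                          ≈⟨ ∑-suc _ ⟩
    ∑ (f zero) ⊕ ∑ (λ i → ∑ (f (suc i)))                        ≈⟨ +-cong ≈-refl (∑-comm (f ∘ suc)) ⟩
    ∑ (f zero) ⊕ ∑ (λ j → ∑ (λ i → f (suc i) j))                ≈⟨ ∑-distrib-+ (f zero) _ ⟨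
    ∑ (λ j → f zero j ⊕ ∑ (λ i → f (suc i) j))                  ≈⟨ ∑-cong (λ j → ∑-suc (λ i → f i j)) ⟨
    ∑ (λ j → ∑ (λ i → f i j))                                   ∎

  ∑-splitAt : ∀ m {k} (f : Fin (m + k) → Carrier) →
              ∑ f ≈ ∑ (λ i → f (i ↑ˡ k)) ⊕ ∑ (λ i → f (m ↑ʳ i))
  ∑-splitAt zero {k} f = begin
    ∑ f                         ≈⟨ +-identityˡ _ ⟨
    0# ⊕ ∑ f                    ≈⟨ +-cong (∑-zero _) ≈-refl ⟨
    ∑ (λ i → f (i ↑ˡ k)) ⊕ ∑ f  ∎
  ∑-splitAt (suc m) {k} f = begin
    ∑ f                                                           ≈⟨ ∑-suc f ⟩
    f zero ⊕ ∑ (f ∘ suc)                                          ≈⟨ +-cong ≈-refl (∑-splitAt m (f ∘ suc)) ⟩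
    f zero ⊕ (∑ (λ i → f (suc (i ↑ˡ k))) ⊕ ∑ (λ i → f (suc m ↑ʳ i))) ≈⟨ +-assoc _ _ _ ⟨
    (f zero ⊕ ∑ (λ i → f (suc (i ↑ˡ k)))) ⊕ ∑ (λ i → f (suc m ↑ʳ i)) ≈⟨ +-cong (∑-suc _) ≈-refl ⟨
    ∑ (λ i → f (i ↑ˡ k)) ⊕ ∑ (λ i → f (suc m ↑ʳ i))                ∎

  ∑-single : ∀ {k} {f : Fin k → Carrier} (t : Fin k) → (∀ j → j ≢ t → f j ≈ 0#) → ∑ f ≈ f t
  ∑-single {suc k} {f} zero f≈0 = begin
    ∑ f                   ≈⟨ ∑-suc f ⟩
    f zero ⊕ ∑ (f ∘ suc)  ≈⟨ +-cong ≈-refl (∑-zeros (λ j → f≈0 (suc j) λ ())) ⟩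
    f zero ⊕ 0#           ≈⟨ +-identityʳ _ ⟩
    f zero                ∎
  ∑-single {suc k} {f} (suc t) f≈0 = begin
    ∑ f                   ≈⟨ ∑-suc f ⟩
    f zero ⊕ ∑ (f ∘ suc)  ≈⟨ +-cong (f≈0 zero λ ()) (∑-single t (λ j j≢t → f≈0 (suc j) (j≢t ∘ suc-injective))) ⟩
    0# ⊕ f (suc t)        ≈⟨ +-identityˡ _ ⟩
    f (suc t)             ∎

  ∑-update : ∀ {k} {f g : Fin k → Carrier} (t : Fin k) (x : Carrier) →
             (∀ j → j ≢ t → f j ≈ g j) → f t ≈ x ⊕ g t → ∑ f ≈ x ⊕ ∑ g
  ∑-update {suc k} {f} {g} zero x f≈g ft = begin
    ∑ f                          ≈⟨ ∑-suc f ⟩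
    f zero ⊕ ∑ (f ∘ suc)         ≈⟨ +-cong ft (∑-cong (λ j → f≈g (suc j) λ ())) ⟩
    (x ⊕ g zero) ⊕ ∑ (g ∘ suc)   ≈⟨ +-assoc _ _ _ ⟩
    x ⊕ (g zero ⊕ ∑ (g ∘ suc))   ≈⟨ +-cong ≈-refl (∑-suc g) ⟨
    x ⊕ ∑ g                      ∎
  ∑-update {suc k} {f} {g} (suc t) x f≈g ft = begin
    ∑ f                          ≈⟨ ∑-suc f ⟩
    f zero ⊕ ∑ (f ∘ suc)         ≈⟨ +-cong (f≈g zero λ ()) (∑-update t x (λ j j≢t → f≈g (suc j) (j≢t ∘ suc-injective)) ft) ⟩
    g zero ⊕ (x ⊕ ∑ (g ∘ suc))   ≈⟨ x∙yz≈y∙xz _ _ _ ⟩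
    x ⊕ (g zero ⊕ ∑ (g ∘ suc))   ≈⟨ +-cong ≈-refl (∑-suc g) ⟨
    x ⊕ ∑ g                      ∎

ℚ-commutativeSemiring : CommutativeSemiring 0ℓ 0ℓ
ℚ-commutativeSemiring = CommutativeRing.commutativeSemiring ℚP.+-*-commutativeRing

module Σℚ = FinSum ℚ-commutativeSemiring Σℚ (λ _ → refl) (λ {_} _ → refl)
module Σℤ = FinSum ℤP.+-*-commutativeSemiring Σℤ (λ _ → refl) (λ {_} _ → refl)
module Σℕ = FinSum ℕP.+-*-commutativeSemiring Σℕ (λ _ → refl) (λ {_} _ → refl)

-i≤+∣i∣ : ∀ i → ℤ.- i ℤ.≤ + ℤ.∣ i ∣
-i≤+∣i∣ (+ zero)  = ℤP.≤-refl
-i≤+∣i∣ ℤ.+[1+ _ ] = ℤ.-≤+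
-i≤+∣i∣ -[1+ _ ]   = ℤP.≤-refl

∣-[1+m]+1∣≡m : ∀ m → ℤ.∣ -[1+ m ] ℤ.+ + 1 ∣ ≡ m
∣-[1+m]+1∣≡m zero    = refl
∣-[1+m]+1∣≡m (suc m) = refl

-[1+∣i+1∣]≡i : ∀ {i} → i ℤ.< + 0 → -[1+ ℤ.∣ i ℤ.+ + 1 ∣ ] ≡ i
-[1+∣i+1∣]≡i { -[1+ m ]} _          = cong -[1+_] (∣-[1+m]+1∣≡m m)
-[1+∣i+1∣]≡i {+ _}      (ℤ.+<+ ())

∣i∣≡1+∣i+1∣ : ∀ {i} → i ℤ.< + 0 → ℤ.∣ i ∣ ≡ suc ℤ.∣ i ℤ.+ + 1 ∣
∣i∣≡1+∣i+1∣ { -[1+ m ]} _          = cong suc (sym (∣-[1+m]+1∣≡m m))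
∣i∣≡1+∣i+1∣ {+ _}      (ℤ.+<+ ())

0≤i+1≢0⇒0≤i : ∀ {i} → + 0 ℤ.≤ i ℤ.+ + 1 → i ℤ.+ + 1 ≢ + 0 → + 0 ℤ.≤ i
0≤i+1≢0⇒0≤i {+ _}           _  _      = ℤ.+≤+ ℕ.z≤n
0≤i+1≢0⇒0≤i { -[1+ zero ]}  _  i+1≢0 = contradiction refl i+1≢0
0≤i+1≢0⇒0≤i { -[1+ suc _ ]} () _

i+n<0⇒i<0 : ∀ {i n} → i ℤ.+ + n ℤ.< + 0 → i ℤ.< + 0
i+n<0⇒i<0 {i} {n} = ℤP.≤-<-trans (ℤP.i≤i+j i (+ n))

+posPart≡i+negPart : ∀ {N} i → + posPart {N} i ≡ i ℤ.+ + negPart {N} i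
+posPart≡i+negPart (+ m)    = sym (ℤP.+-identityʳ (+ m))
+posPart≡i+negPart -[1+ m ] = sym (ℤP.+-inverseˡ (+ suc m))

≤-Σℕ : ∀ {k} (f : Fin k → ℕ) j → f j ℕ.≤ Σℕ f
≤-Σℕ f zero    = ℕP.m≤m+n (f zero) _
≤-Σℕ f (suc j) = ℕP.≤-trans (≤-Σℕ (f ∘ suc) j) (ℕP.m≤n+m _ (f zero))

Πfact-cong : ∀ {k} {f g : Fin k → ℕ} → f ≗ g → Πfact f ≡ Πfact g
Πfact-cong {zero}  f≗g = refl
Πfact-cong {suc k} f≗g = cong₂ ℕ._*_ (cong _! (f≗g zero)) (Πfact-cong (f≗g ∘ suc))

Πfact-update : ∀ {k} {f g : Fin k → ℕ} (t : Fin k) → (∀ i → i ≢ t → f i ≡ g i) → f t ≡ suc (g t) →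
               Πfact f ≡ suc (g t) ℕ.* Πfact g
Πfact-update {f = f} {g} zero f≡g ft = begin
  f zero ! ℕ.* Πfact (f ∘ suc)              ≡⟨ cong₂ ℕ._*_ (cong _! ft) (Πfact-cong (λ i → f≡g (suc i) λ ())) ⟩
  suc (g zero) ! ℕ.* Πfact (g ∘ suc)        ≡⟨ ℕP.*-assoc (suc (g zero)) (g zero !) _ ⟩
  suc (g zero) ℕ.* (g zero ! ℕ.* Πfact (g ∘ suc)) ∎
  where open ≡-Reasoning
Πfact-update {f = f} {g} (suc t) f≡g ft = begin
  f zero ! ℕ.* Πfact (f ∘ suc)                   ≡⟨ cong₂ ℕ._*_ (cong _! (f≡g zero λ ())) (Πfact-update t (λ i i≢t → f≡g (suc i) (i≢t ∘ suc-injective)) ft) ⟩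
  g zero ! ℕ.* (suc (g (suc t)) ℕ.* Πfact (g ∘ suc)) ≡⟨ x∙yz≈y∙xz (g zero !) (suc (g (suc t))) _ ⟩
  suc (g (suc t)) ℕ.* (g zero ! ℕ.* Πfact (g ∘ suc)) ∎
  where
  open ≡-Reasoning
  open import Algebra.Properties.CommutativeSemigroup ℕP.*-commutativeSemigroup using (x∙yz≈y∙xz)

toℚᵘ-toℚ : ∀ a → ℚ.toℚᵘ (toℚ a) ℚᵘ.≃ mkℚᵘ a 0
toℚᵘ-toℚ a = ℚP.toℚᵘ-fromℚᵘ (mkℚᵘ a 0)

toℚ-via-ℚᵘ : ∀ {a} {p : ℚ} → mkℚᵘ a 0 ℚᵘ.≃ ℚ.toℚᵘ p → toℚ a ≡ p
toℚ-via-ℚᵘ {a} eq = ℚP.toℚᵘ-injective (ℚᵘP.≃-trans (toℚᵘ-toℚ a) eq)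

toℚ-+ : ∀ a b → toℚ (a ℤ.+ b) ≡ toℚ a ℚ.+ toℚ b
toℚ-+ a b = toℚ-via-ℚᵘ (begin
  mkℚᵘ (a ℤ.+ b) 0                  ≈⟨ *≡* (solve 2 (λ x y → (x :+ y) :* con (+ 1) := (x :* con (+ 1) :+ y :* con (+ 1)) :* con (+ 1)) refl a b) ⟩
  mkℚᵘ a 0 ℚᵘ.+ mkℚᵘ b 0             ≈⟨ ℚᵘP.+-cong (toℚᵘ-toℚ a) (toℚᵘ-toℚ b) ⟨
  ℚ.toℚᵘ (toℚ a) ℚᵘ.+ ℚ.toℚᵘ (toℚ b) ≈⟨ ℚP.toℚᵘ-homo-+ (toℚ a) (toℚ b) ⟨
  ℚ.toℚᵘ (toℚ a ℚ.+ toℚ b)           ∎)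
  where
    open ℚᵘP.≃-Reasoning
    open ℤSolver.+-*-Solver

toℚ-* : ∀ a b → toℚ (a ℤ.* b) ≡ toℚ a ℚ.* toℚ b
toℚ-* a b = toℚ-via-ℚᵘ (begin
  mkℚᵘ (a ℤ.* b) 0                   ≈⟨ *≡* (solve 2 (λ x y → (x :* y) :* con (+ 1) := (x :* y) :* (con (+ 1) :* con (+ 1))) refl a b) ⟩
  mkℚᵘ a 0 ℚᵘ.* mkℚᵘ b 0             ≈⟨ ℚᵘP.*-cong (toℚᵘ-toℚ a) (toℚᵘ-toℚ b) ⟨
  ℚ.toℚᵘ (toℚ a) ℚᵘ.* ℚ.toℚᵘ (toℚ b) ≈⟨ ℚP.toℚᵘ-homo-* (toℚ a) (toℚ b) ⟨
  ℚ.toℚᵘ (toℚ a ℚ.* toℚ b)           ∎)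
  where
    open ℚᵘP.≃-Reasoning
    open ℤSolver.+-*-Solver

toℚ-neg : ∀ a → toℚ (ℤ.- a) ≡ ℚ.- toℚ a
toℚ-neg a = toℚ-via-ℚᵘ (ℚᵘP.≃-sym (ℚᵘP.≃-trans (ℚP.toℚᵘ-homo‿- (toℚ a)) (ℚᵘP.-‿cong (toℚᵘ-toℚ a))))

toℚ-injective : ∀ {a b} → toℚ a ≡ toℚ b → a ≡ b
toℚ-injective {a} {b} eq with ℚᵘP.≃-trans (ℚᵘP.≃-sym (toℚᵘ-toℚ a)) (ℚᵘP.≃-trans (ℚP.toℚᵘ-cong eq) (toℚᵘ-toℚ b))
... | *≡* a*1≡b*1 = trans (sym (ℤP.*-identityʳ a)) (trans a*1≡b*1 (ℤP.*-identityʳ b))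

toℚ-mono-≤ : ∀ {a b} → a ℤ.≤ b → toℚ a ℚ.≤ toℚ b
toℚ-mono-≤ {a} {b} a≤b = ℚP.toℚᵘ-cancel-≤
  (ℚᵘP.≤-respˡ-≃ (ℚᵘP.≃-sym (toℚᵘ-toℚ a)) (ℚᵘP.≤-respʳ-≃ (ℚᵘP.≃-sym (toℚᵘ-toℚ b))
    (*≤* (subst₂ ℤ._≤_ (sym (ℤP.*-identityʳ a)) (sym (ℤP.*-identityʳ b)) a≤b))))

toℚ-mono-< : ∀ {a b} → a ℤ.< b → toℚ a ℚ.< toℚ b
toℚ-mono-< {a} {b} a<b = ℚP.toℚᵘ-cancel-<
  (ℚᵘP.<-respˡ-≃ (ℚᵘP.≃-sym (toℚᵘ-toℚ a)) (ℚᵘP.<-respʳ-≃ (ℚᵘP.≃-sym (toℚᵘ-toℚ b))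
    (*<* (subst₂ ℤ._<_ (sym (ℤP.*-identityʳ a)) (sym (ℤP.*-identityʳ b)) a<b))))

toℚ-Σℤ : ∀ {k} (f : Fin k → ℤ) → toℚ (Σℤ f) ≡ Σℚ (toℚ ∘ f)
toℚ-Σℤ {zero}  f = refl
toℚ-Σℤ {suc k} f = trans (toℚ-+ (f zero) (Σℤ (f ∘ suc))) (cong (toℚ (f zero) ℚ.+_) (toℚ-Σℤ (f ∘ suc)))

toℚᵘ-/ : ∀ z d .{{_ : ℕ.NonZero d}} → ℚ.toℚᵘ (z ℚ./ d) ℚᵘ.≃ mkℚᵘ z (ℕ.pred d)
toℚᵘ-/ z (suc d) = ℚP.toℚᵘ-fromℚᵘ (mkℚᵘ z d)

toℚ-*-/ : ∀ c z d .{{_ : ℕ.NonZero d}} → toℚ c ℚ.* (z ℚ./ d) ≡ (c ℤ.* z) ℚ./ d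
toℚ-*-/ c z (suc d) = ℚP.toℚᵘ-injective (begin
  ℚ.toℚᵘ (toℚ c ℚ.* (z ℚ./ suc d))          ≈⟨ ℚP.toℚᵘ-homo-* (toℚ c) (z ℚ./ suc d) ⟩
  ℚ.toℚᵘ (toℚ c) ℚᵘ.* ℚ.toℚᵘ (z ℚ./ suc d)  ≈⟨ ℚᵘP.*-cong (toℚᵘ-toℚ c) (toℚᵘ-/ z (suc d)) ⟩
  mkℚᵘ c 0 ℚᵘ.* mkℚᵘ z d                    ≈⟨ *≡* (solve 3 (λ c z e → (c :* z) :* e := (c :* z) :* (con (+ 1) :* e)) refl c z (+ suc d)) ⟩
  mkℚᵘ (c ℤ.* z) d                          ≈⟨ toℚᵘ-/ (c ℤ.* z) (suc d) ⟨
  ℚ.toℚᵘ ((c ℤ.* z) ℚ./ suc d)               ∎)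
  where
    open ℚᵘP.≃-Reasoning
    open ℤSolver.+-*-Solver

toℚ-*-/-cancel : ∀ z m d .{{_ : ℕ.NonZero d}} →
                 toℚ (+ suc m) ℚ.* ((z ℚ./ (suc m ℕ.* d)) {{ℕP.m*n≢0 (suc m) d}}) ≡ z ℚ./ d
toℚ-*-/-cancel z m (suc d) = ℚP.toℚᵘ-injective (begin
  ℚ.toℚᵘ (toℚ (+ suc m) ℚ.* (z ℚ./ (suc m ℕ.* suc d)))             ≈⟨ ℚP.toℚᵘ-homo-* (toℚ (+ suc m)) _ ⟩
  ℚ.toℚᵘ (toℚ (+ suc m)) ℚᵘ.* ℚ.toℚᵘ (z ℚ./ (suc m ℕ.* suc d))     ≈⟨ ℚᵘP.*-cong (toℚᵘ-toℚ (+ suc m)) (toℚᵘ-/ z (suc m ℕ.* suc d)) ⟩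
  mkℚᵘ (+ suc m) 0 ℚᵘ.* mkℚᵘ z (ℕ.pred (suc m ℕ.* suc d))           ≈⟨ *≡* eq ⟩
  mkℚᵘ z d                                                        ≈⟨ toℚᵘ-/ z (suc d) ⟨
  ℚ.toℚᵘ (z ℚ./ suc d)                                             ∎)
  where
  open ℚᵘP.≃-Reasoning
  open ℤSolver.+-*-Solver
  eq : (+ suc m ℤ.* z) ℤ.* + suc d ≡ z ℤ.* (+ 1 ℤ.* + (suc m ℕ.* suc d))
  eq = trans (solve 3 (λ a b e → (a :* b) :* e := b :* (con (+ 1) :* (a :* e))) refl (+ suc m) z (+ suc d))
             (cong (λ t → z ℤ.* (+ 1 ℤ.* t)) (sym (ℤP.pos-* (suc m) (suc d))))

0≤-* : ∀ {p q} → 0ℚ ℚ.≤ p → 0ℚ ℚ.≤ q → 0ℚ ℚ.≤ p ℚ.* q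
0≤-* {p} {q} 0≤p 0≤q = ℚP.nonNegative⁻¹ _ {{ℚP.nonNeg*nonNeg⇒nonNeg p {{ℚ.nonNegative 0≤p}} q {{ℚ.nonNegative 0≤q}}}}

p*q≡0⇒q≡0 : ∀ {p q} → p ≢ 0ℚ → p ℚ.* q ≡ 0ℚ → q ≡ 0ℚ
p*q≡0⇒q≡0 {p} {q} p≢0 pq≡0 = begin
  q                   ≡⟨ ℚP.*-identityˡ q ⟨
  1ℚ ℚ.* q            ≡⟨ cong (ℚ._* q) (ℚP.*-inverseˡ p) ⟨
  ℚ.1/ p ℚ.* p ℚ.* q  ≡⟨ ℚP.*-assoc (ℚ.1/ p) p q ⟩
  ℚ.1/ p ℚ.* (p ℚ.* q) ≡⟨ cong (ℚ.1/ p ℚ.*_) pq≡0 ⟩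
  ℚ.1/ p ℚ.* 0ℚ       ≡⟨ ℚP.*-zeroʳ (ℚ.1/ p) ⟩
  0ℚ                  ∎
  where
  open ≡-Reasoning
  instance
    p-nonZero : ℚ.NonZero p
    p-nonZero = ℚ.≢-nonZero p≢0

≡-byCases : ∀ {P : Set} {p q : ℚ} → (P → p ≡ q) → (¬ P → p ≡ q) → p ≡ q
≡-byCases {p = p} {q} if-P if-¬P = decidable-stable (p ℚP.≟ q) (λ p≢q → p≢q (if-¬P (λ P → p≢q (if-P P))))

Σℚ-neg : ∀ {k} (f : Fin k → ℚ) → Σℚ (λ j → ℚ.- f j) ≡ ℚ.- Σℚ f
Σℚ-neg {zero}  f = refl
Σℚ-neg {suc k} f = trans (cong (ℚ.- f zero ℚ.+_) (Σℚ-neg (f ∘ suc))) (sym (ℚP.neg-distrib-+ (f zero) _))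

0≤Σℚ : ∀ {k} (f : Fin k → ℚ) → (∀ j → 0ℚ ℚ.≤ f j) → 0ℚ ℚ.≤ Σℚ f
0≤Σℚ {zero}  f 0≤f = ℚP.≤-refl
0≤Σℚ {suc k} f 0≤f = ℚP.+-mono-≤ (0≤f zero) (0≤Σℚ (f ∘ suc) (0≤f ∘ suc))

Σℚ≡0⇒≡0 : ∀ {k} (f : Fin k → ℚ) → (∀ j → 0ℚ ℚ.≤ f j) → Σℚ f ≡ 0ℚ → ∀ j → f j ≡ 0ℚ
Σℚ≡0⇒≡0 {suc k} f 0≤f Σf≡0 = head-and-tail
  where
  f0≡0 : f zero ≡ 0ℚ
  f0≡0 = ℚP.≤-antisym
    (subst (f zero ℚ.≤_) Σf≡0 (subst (ℚ._≤ Σℚ f) (ℚP.+-identityʳ (f zero)) (ℚP.+-monoʳ-≤ (f zero) (0≤Σℚ (f ∘ suc) (0≤f ∘ suc)))))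
    (0≤f zero)
  head-and-tail : ∀ j → f j ≡ 0ℚ
  head-and-tail zero    = f0≡0
  head-and-tail (suc j) = Σℚ≡0⇒≡0 (f ∘ suc) (0≤f ∘ suc)
    (trans (sym (ℚP.+-identityˡ (Σℚ (f ∘ suc)))) (trans (cong (ℚ._+ Σℚ (f ∘ suc)) (sym f0≡0)) Σf≡0)) j

small-scale : ∀ {k} (y : Fin k → ℤ) → Σ ℚ λ r → 0ℚ ℚ.< r × (∀ j → 0ℚ ℚ.≤ 1ℚ ℚ.+ r ℚ.* toℚ (y j))
small-scale y = r , 0<r , 0≤1+ry
  where
  m : ℕ
  m = suc (Σℕ (λ j → ℤ.∣ y j ∣))
  0<m : 0ℚ ℚ.< toℚ (+ m)
  0<m = toℚ-mono-< {+ 0} {+ m} (ℤ.+<+ (ℕ.s≤s ℕ.z≤n))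
  instance
    m-pos : ℚ.Positive (toℚ (+ m))
    m-pos = ℚ.positive 0<m
    m≢0 : ℚ.NonZero (toℚ (+ m))
    m≢0 = ℚP.pos⇒nonZero (toℚ (+ m))
  r : ℚ
  r = ℚ.1/ toℚ (+ m)
  0<r : 0ℚ ℚ.< r
  0<r = ℚP.positive⁻¹ r {{ℚP.1/pos⇒pos (toℚ (+ m))}}
  0≤1+ry : ∀ j → 0ℚ ℚ.≤ 1ℚ ℚ.+ r ℚ.* toℚ (y j)
  0≤1+ry j = subst (ℚ._≤ 1ℚ ℚ.+ x) (ℚP.+-inverseˡ x) (ℚP.+-monoˡ-≤ x -x≤1)
    where
    x : ℚ
    x = r ℚ.* toℚ (y j)
    -y≤m : ℤ.- y j ℤ.≤ + m
    -y≤m = ℤP.≤-trans (-i≤+∣i∣ (y j)) (ℤ.+≤+ (ℕP.≤-trans (≤-Σℕ (λ j → ℤ.∣ y j ∣) j) (ℕP.n≤1+n _)))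
    -x≤1 : ℚ.- x ℚ.≤ 1ℚ
    -x≤1 = begin
      ℚ.- x                  ≡⟨ ℚP.neg-distribʳ-* r (toℚ (y j)) ⟩
      r ℚ.* ℚ.- toℚ (y j)    ≡⟨ cong (r ℚ.*_) (toℚ-neg (y j)) ⟨
      r ℚ.* toℚ (ℤ.- y j)    ≤⟨ ℚP.*-monoˡ-≤-nonNeg r {{ℚ.nonNegative (ℚP.<⇒≤ 0<r)}} (toℚ-mono-≤ -y≤m) ⟩
      r ℚ.* toℚ (+ m)        ≡⟨ ℚP.*-inverseˡ (toℚ (+ m)) ⟩
      1ℚ                     ∎
      where open ℚP.≤-Reasoning

module _ {N : ℕ} where

  δ-refl : (j : Fin N) → δ j j ≡ + 1
  δ-refl j with j Fin.≟ j
  ... | yes _   = refl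
  ... | no j≢j = contradiction refl j≢j

  δ-≢ : {j k : Fin N} → j ≢ k → δ j k ≡ + 0
  δ-≢ {j} {k} j≢k with j Fin.≟ k
  ... | yes j≡k = contradiction j≡k j≢k
  ... | no _    = refl

  0≤δ : (j k : Fin N) → + 0 ℤ.≤ δ j k
  0≤δ j k with j Fin.≟ k
  ... | yes _ = ℤ.+≤+ ℕ.z≤n
  ... | no _  = ℤ.+≤+ ℕ.z≤n

  δℕ : Fin N → Fin N → ℕ
  δℕ j k = ℤ.∣ δ j k ∣

  +δℕ≡δ : (j k : Fin N) → + δℕ j k ≡ δ j k
  +δℕ≡δ j k with j Fin.≟ k
  ... | yes _ = refl
  ... | no _  = refl

  Extensional : Series N → Set
  Extensional G = ∀ {x x′} → x ≗ x′ → G x ≡ G x′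

  mulΛ-∂ : ∀ {G} → Extensional G → ∀ j e → mulΛ j (∂ j G) e ≡ toℚ (e j) ℚ.* G e
  mulΛ-∂ {G} G-ext j e = cong₂ ℚ._*_
    (cong toℚ (trans (cong (λ d → e j ℤ.- d ℤ.+ + 1) (δ-refl j)) (minus-plus (e j) (+ 1))))
    (G-ext (λ k → minus-plus (e k) (δ j k)))
    where
    open ℤSolver.+-*-Solver
    minus-plus : ∀ a d → a ℤ.- d ℤ.+ d ≡ a
    minus-plus = solve 2 (λ a d → a :- d :+ d := a) refl

module _ {n : ℕ} where

  infixl 6 _+ᵖ_ _-ᵖ_
  infixl 7 _*ᵖ_

  _+ᵖ_ _-ᵖ_ : Point n → Point n → Point n
  (x +ᵖ y) i = x i ℚ.+ y i
  (x -ᵖ y) i = x i ℚ.- y i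

  _*ᵖ_ : ℚ → Point n → Point n
  (c *ᵖ x) i = c ℚ.* x i

  0ᵖ : Point n
  0ᵖ _ = 0ℚ

  ·-congˡ : (w : Point n) {x y : Point n} → x ≗ y → w · x ≡ w · y
  ·-congˡ w x≗y = Σℚ.∑-cong {n} (λ i → cong (w i ℚ.*_) (x≗y i))

  ·-distrib-+ᵖ : (w x y : Point n) → w · (x +ᵖ y) ≡ w · x ℚ.+ w · y
  ·-distrib-+ᵖ w x y = trans (Σℚ.∑-cong {n} (λ i → ℚP.*-distribˡ-+ (w i) (x i) (y i))) (Σℚ.∑-distrib-+ {n} _ _)

  ·-*ᵖ : (w : Point n) (c : ℚ) (x : Point n) → w · (c *ᵖ x) ≡ c ℚ.* (w · x)
  ·-*ᵖ w c x = trans (Σℚ.∑-cong {n} (λ i → x∙yz≈y∙xz (w i) c (x i))) (Σℚ.∑-distribˡ-* {n} c _)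
    where open import Algebra.Properties.CommutativeSemigroup (CommutativeSemiring.*-commutativeSemigroup ℚ-commutativeSemiring) using (x∙yz≈y∙xz)

  ·-0ᵖ : (w : Point n) → w · 0ᵖ ≡ 0ℚ
  ·-0ᵖ w = Σℚ.∑-zeros {n} (λ i → ℚP.*-zeroʳ (w i))

  ·-neg : (w x : Point n) → w · (λ i → ℚ.- x i) ≡ ℚ.- (w · x)
  ·-neg w x = trans (Σℚ.∑-cong {n} (λ i → sym (ℚP.neg-distribʳ-* (w i) (x i)))) (Σℚ-neg {n} _)

  ·-Σℚ : ∀ {m} (w : Point n) (g : Fin m → Point n) → w · (λ i → Σℚ (λ k → g k i)) ≡ Σℚ (λ k → w · g k)
  ·-Σℚ {m} w g = trans (Σℚ.∑-cong {n} (λ i → sym (Σℚ.∑-distribˡ-* (w i) (λ k → g k i)))) (Σℚ.∑-comm {n} {m} _)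

  weightSum : List (ℚ × Point n) → ℚ
  weightSum = foldr (λ c s → proj₁ c ℚ.+ s) 0ℚ

  affComb : List (ℚ × Point n) → Point n
  affComb cs i = foldr (λ c s → (proj₁ c ℚ.* proj₂ c i) ℚ.+ s) 0ℚ cs

  scaleWeights : ℚ → List (ℚ × Point n) → List (ℚ × Point n)
  scaleWeights r = map (λ c → proj₁ c ℚ.* r , proj₂ c)

  weightSum-scale : ∀ r cs → weightSum (scaleWeights r cs) ≡ weightSum cs ℚ.* r
  weightSum-scale r []             = sym (ℚP.*-zeroˡ r)
  weightSum-scale r ((t , p) ∷ cs) =
    trans (cong (t ℚ.* r ℚ.+_) (weightSum-scale r cs)) (sym (ℚP.*-distribʳ-+ r t (weightSum cs)))

  affComb-scale : ∀ r cs i → affComb (scaleWeights r cs) i ≡ r ℚ.* affComb cs i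
  affComb-scale r []             i = sym (ℚP.*-zeroʳ r)
  affComb-scale r ((t , p) ∷ cs) i = trans (cong ((t ℚ.* r) ℚ.* p i ℚ.+_) (affComb-scale r cs i))
    (solve 4 (λ t r p s → (t :* r) :* p :+ r :* s := r :* (t :* p :+ s)) refl t r (p i) (affComb cs i))
    where open ℚSolver.+-*-Solver

record IsConvexCone {n : ℕ} (S : Point n → Set) : Set where
  field
    resp     : ∀ {x y} → x ≗ y → S x → S y
    0∈       : S 0ᵖ
    +-closed : ∀ {x y} → S x → S y → S (x +ᵖ y)
    *-closed : ∀ {c x} → 0ℚ ℚ.≤ c → S x → S (c *ᵖ x)

module Configuration {n : ℕ} (M K : ℕ) (A : Fin (M + K) → Lat n) where

  N : ℕ
  N = M + K

  a : Fin N → Point n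
  a j = embed (A j)

  combination : (Fin N → ℚ) → Point n
  combination d i = Σℚ (λ j → d j ℚ.* toℚ (A j i))

  ·-combination : (w : Point n) (d : Fin N → ℚ) → w · combination d ≡ Σℚ (λ j → d j ℚ.* (w · a j))
  ·-combination w d = trans (·-Σℚ w (λ j → d j *ᵖ a j)) (Σℚ.∑-cong {N} (λ j → ·-*ᵖ w (d j) (a j)))

  combination∈C : (d : Fin N → ℚ) → (∀ j → 0ℚ ℚ.≤ d j) → InCone M K A (combination d)
  combination∈C d 0≤d = d , 0≤d , λ i → refl

  a∈C : ∀ j → InCone M K A (a j)
  a∈C j = toℚ ∘ δ j , (λ k → toℚ-mono-≤ (0≤δ j k)) , λ i → sym (begin
    Σℚ (λ k → toℚ (δ j k) ℚ.* toℚ (A k i))  ≡⟨ Σℚ.∑-single j (λ k k≢j → trans (cong (λ z → toℚ z ℚ.* toℚ (A k i)) (δ-≢ (k≢j ∘ sym))) (ℚP.*-zeroˡ (toℚ (A k i)))) ⟩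
    toℚ (δ j j) ℚ.* toℚ (A j i)             ≡⟨ cong (λ z → toℚ z ℚ.* toℚ (A j i)) (δ-refl j) ⟩
    1ℚ ℚ.* toℚ (A j i)                      ≡⟨ ℚP.*-identityˡ _ ⟩
    toℚ (A j i)                             ∎)
    where open ≡-Reasoning

  supporting⇒0≤·a : ∀ w → Supporting M K A w → ∀ j → 0ℚ ℚ.≤ w · a j
  supporting⇒0≤·a w sup j = sup (a j) (a∈C j)

  cone-isConvexCone : IsConvexCone (InCone M K A)
  cone-isConvexCone = record
    { resp     = λ x≗y (c , 0≤c , x≡) → c , 0≤c , λ i → trans (sym (x≗y i)) (x≡ i)
    ; 0∈       = (λ _ → 0ℚ) , (λ _ → ℚP.≤-refl) , λ i → sym (Σℚ.∑-zeros {N} (λ j → ℚP.*-zeroˡ (toℚ (A j i))))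
    ; +-closed = λ (c , 0≤c , x≡) (d , 0≤d , y≡) → (λ j → c j ℚ.+ d j) , (λ j → ℚP.+-mono-≤ (0≤c j) (0≤d j)) ,
                 λ i → trans (cong₂ ℚ._+_ (x≡ i) (y≡ i))
                         (trans (sym (Σℚ.∑-distrib-+ {N} _ _)) (Σℚ.∑-cong {N} (λ j → sym (ℚP.*-distribʳ-+ (toℚ (A j i)) (c j) (d j)))))
    ; *-closed = λ {t} 0≤t (c , 0≤c , x≡) → (λ j → t ℚ.* c j) , (λ j → 0≤-* 0≤t (0≤c j)) ,
                 λ i → trans (cong (t ℚ.*_) (x≡ i))
                         (trans (sym (Σℚ.∑-distribˡ-* {N} t _)) (Σℚ.∑-cong {N} (λ j → sym (ℚP.*-assoc t (c j) (toℚ (A j i))))))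
    }

  face-isConvexCone : ∀ b → IsConvexCone (InFaceOf M K A b)
  face-isConvexCone b = record
    { resp     = λ x≗y (x∈C , x⊥) → C.resp x≗y x∈C , λ w sup w⊥b → trans (sym (·-congˡ w x≗y)) (x⊥ w sup w⊥b)
    ; 0∈       = C.0∈ , λ w _ _ → ·-0ᵖ w
    ; +-closed = λ (x∈C , x⊥) (y∈C , y⊥) → C.+-closed x∈C y∈C , λ w sup w⊥b →
                 trans (·-distrib-+ᵖ w _ _) (cong₂ ℚ._+_ (x⊥ w sup w⊥b) (y⊥ w sup w⊥b))
    ; *-closed = λ {c} 0≤c (x∈C , x⊥) → C.*-closed 0≤c x∈C , λ w sup w⊥b →
                 trans (·-*ᵖ w c _) (trans (cong (c ℚ.*_) (x⊥ w sup w⊥b)) (ℚP.*-zeroʳ c))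
    }
    where module C = IsConvexCone cone-isConvexCone

  module _ {S : Point n → Set} (cone : IsConvexCone S) where
    open IsConvexCone cone

    affHull-shift : ∀ {c} → S c → (μ : ℚ) (y : Point n) → InAffHull M K A S y → InAffHull M K A S (μ *ᵖ (y -ᵖ c))
    affHull-shift {c} c∈S μ y (cs , cs⊆S , Σcs≡1 , y≡) =
      (ℚ.- μ , c) ∷ (1ℚ , 0ᵖ) ∷ scaleWeights μ cs ,
      c∈S ∷ 0∈ ∷ All.map⁺ cs⊆S ,
      trans (cong (λ s → ℚ.- μ ℚ.+ (1ℚ ℚ.+ s)) (trans (weightSum-scale μ cs) (cong (ℚ._* μ) Σcs≡1)))
            (solve 1 (λ m → :- m :+ (con 1ℚ :+ con 1ℚ :* m) := con 1ℚ) refl μ) ,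
      λ i → trans (cong (λ t → μ ℚ.* (t ℚ.- c i)) (y≡ i)) (sym
              (trans (cong (λ t → ℚ.- μ ℚ.* c i ℚ.+ (1ℚ ℚ.* 0ℚ ℚ.+ t)) (affComb-scale μ cs i))
                     (solve 3 (λ m x s → :- m :* x :+ (con 1ℚ :* con 0ℚ :+ m :* s) := m :* (s :- x)) refl μ (c i) (affComb cs i))))
      where open ℚSolver.+-*-Solver

    relInt-resp : ∀ {x y} → x ≗ y → InRelInt M K A S x → InRelInt M K A S y
    relInt-resp x≗y (x∈S , ε , 0<ε , ball) = resp x≗y x∈S , ε , 0<ε ,
      λ z z∈aff near → ball z z∈aff (λ i → subst (λ t → ℚ.∣ z i ℚ.- t ∣ ℚ.< ε) (sym (x≗y i)) (near i))

    relInt-shift : ∀ {z c r} → 0ℚ ℚ.< r → InRelInt M K A S z → S c → InRelInt M K A S (r *ᵖ z +ᵖ c)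
    relInt-shift {z} {c} {r} 0<r (z∈S , ε , 0<ε , ball) c∈S =
      +-closed (*-closed (ℚP.<⇒≤ 0<r) z∈S) c∈S , r ℚ.* ε , 0<rε , ball′
      where
      instance
        r-pos : ℚ.Positive r
        r-pos = ℚ.positive 0<r
        ε-pos : ℚ.Positive ε
        ε-pos = ℚ.positive 0<ε
        r≢0 : ℚ.NonZero r
        r≢0 = ℚP.pos⇒nonZero r
      0<rε : 0ℚ ℚ.< r ℚ.* ε
      0<rε = ℚP.positive⁻¹ _ {{ℚP.pos*pos⇒pos r ε}}
      μ : ℚ
      μ = ℚ.1/ r
      instance
        μ-pos : ℚ.Positive μ
        μ-pos = ℚP.1/pos⇒pos r
      open ℚSolver.+-*-Solver
      ball′ : ∀ y → InAffHull M K A S y → (∀ i → ℚ.∣ y i ℚ.- (r ℚ.* z i ℚ.+ c i) ∣ ℚ.< r ℚ.* ε) → S y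
      ball′ y y∈aff near = resp y′↦y (+-closed (*-closed (ℚP.<⇒≤ 0<r) y′∈S) c∈S)
        where
        y′ : Point n
        y′ = μ *ᵖ (y -ᵖ c)
        y′-z : ∀ i → y′ i ℚ.- z i ≡ μ ℚ.* (y i ℚ.- (r ℚ.* z i ℚ.+ c i))
        y′-z i = begin
          μ ℚ.* (y i ℚ.- c i) ℚ.- z i                 ≡⟨ cong (λ t → μ ℚ.* (y i ℚ.- c i) ℚ.- t) (ℚP.*-identityˡ (z i)) ⟨
          μ ℚ.* (y i ℚ.- c i) ℚ.- 1ℚ ℚ.* z i          ≡⟨ cong (λ t → μ ℚ.* (y i ℚ.- c i) ℚ.- t ℚ.* z i) (ℚP.*-inverseˡ r) ⟨
          μ ℚ.* (y i ℚ.- c i) ℚ.- (μ ℚ.* r) ℚ.* z i   ≡⟨ solve 5 (λ m r y z c → m :* (y :- c) :- (m :* r) :* z := m :* (y :- (r :* z :+ c))) refl μ r (y i) (z i) (c i) ⟩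
          μ ℚ.* (y i ℚ.- (r ℚ.* z i ℚ.+ c i))          ∎
          where open ≡-Reasoning
        y′∈S : S y′
        y′∈S = ball y′ (affHull-shift c∈S μ y y∈aff) λ i → subst₂ ℚ._<_
          (sym (trans (cong ℚ.∣_∣ (y′-z i)) (trans (ℚP.∣p*q∣≡∣p∣*∣q∣ μ _) (cong (ℚ._* ℚ.∣ y i ℚ.- (r ℚ.* z i ℚ.+ c i) ∣) (ℚP.0≤p⇒∣p∣≡p (ℚP.<⇒≤ (ℚP.positive⁻¹ μ)))))))
          (trans (sym (ℚP.*-assoc μ r ε)) (trans (cong (ℚ._* ε) (ℚP.*-inverseˡ r)) (ℚP.*-identityˡ ε)))
          (ℚP.*-monoʳ-<-pos μ (near i))
        y′↦y : r *ᵖ y′ +ᵖ c ≗ y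
        y′↦y i = begin
          r ℚ.* (μ ℚ.* (y i ℚ.- c i)) ℚ.+ c i ≡⟨ cong (ℚ._+ c i) (ℚP.*-assoc r μ _) ⟨
          r ℚ.* μ ℚ.* (y i ℚ.- c i) ℚ.+ c i   ≡⟨ cong (λ t → t ℚ.* (y i ℚ.- c i) ℚ.+ c i) (ℚP.*-inverseʳ r) ⟩
          1ℚ ℚ.* (y i ℚ.- c i) ℚ.+ c i        ≡⟨ solve 2 (λ y c → con 1ℚ :* (y :- c) :+ c := y) refl (y i) (c i) ⟩
          y i                                 ∎
          where open ≡-Reasoning

  σβ-isConvexCone : IsConvexCone (σβ M K A)
  σβ-isConvexCone = face-isConvexCone (embed (β M K A))

  head∈σβ : ∀ k → σβ M K A (a (k ↑ˡ K))
  head∈σβ k = a∈C (k ↑ˡ K) , λ w sup w⊥β →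
    Σℚ≡0⇒≡0 (λ k′ → w · a (k′ ↑ˡ K)) (λ k′ → supporting⇒0≤·a w sup (k′ ↑ˡ K))
      (trans (sym (·-Σℚ w (λ k′ → a (k′ ↑ˡ K))))
        (trans (sym (·-congˡ w (λ i → toℚ-Σℤ (λ k′ → A (k′ ↑ˡ K) i)))) w⊥β)) k

  combination∈σβ : (d : Fin N → ℚ) → (∀ j → 0ℚ ℚ.≤ d j) → (∀ j → d j ≡ 0ℚ ⊎ σβ M K A (a j)) →
                   σβ M K A (combination d)
  combination∈σβ d 0≤d d⊆σβ = combination∈C d 0≤d , λ w sup w⊥β →
    trans (·-combination w d) (Σℚ.∑-zeros {N} (λ j → term w sup w⊥β j (d⊆σβ j)))
    where
    term : ∀ w → Supporting M K A w → w · embed (β M K A) ≡ 0ℚ →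
           ∀ j → d j ≡ 0ℚ ⊎ σβ M K A (a j) → d j ℚ.* (w · a j) ≡ 0ℚ
    term w _   _   j (inj₁ dj≡0)     = trans (cong (ℚ._* (w · a j)) dj≡0) (ℚP.*-zeroˡ (w · a j))
    term w sup w⊥β j (inj₂ (_ , aj⊥)) = trans (cong (d j ℚ.*_) (aj⊥ w sup w⊥β)) (ℚP.*-zeroʳ (d j))

  expo-↑ˡ : ∀ l k → expo M K A l (k ↑ˡ K) ≡ -[1+ l (k ↑ˡ K) ]
  expo-↑ˡ l k rewrite splitAt-↑ˡ M k K = refl

  expo-↑ʳ : ∀ l k → expo M K A l (M ↑ʳ k) ≡ + l (M ↑ʳ k)
  expo-↑ʳ l k rewrite splitAt-↑ʳ M K k = refl

  χ : Subset M → Fin N → ℤ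
  χ J j with splitAt M j
  ... | inj₁ k = if lookup J k then + 1 else + 0
  ... | inj₂ _ = + 0

  χ-↑ˡ : ∀ J k → χ J (k ↑ˡ K) ≡ (if lookup J k then + 1 else + 0)
  χ-↑ˡ J k rewrite splitAt-↑ˡ M k K = refl

  χ-↑ʳ : ∀ J k → χ J (M ↑ʳ k) ≡ + 0
  χ-↑ʳ J k rewrite splitAt-↑ʳ M K k = refl

  subsetSum≡Σχ : ∀ J i → subsetSum M K A J i ≡ Σℤ (λ j → χ J j ℤ.* A j i)
  subsetSum≡Σχ J i = sym (begin
    Σℤ (λ j → χ J j ℤ.* A j i)                                  ≡⟨ Σℤ.∑-splitAt M _ ⟩
    Σℤ (λ k → χ J (k ↑ˡ K) ℤ.* A (k ↑ˡ K) i) ℤ.+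
      Σℤ (λ k → χ J (M ↑ʳ k) ℤ.* A (M ↑ʳ k) i)                  ≡⟨ cong₂ ℤ._+_ (Σℤ.∑-cong {M} head) (Σℤ.∑-zeros {K} tail) ⟩
    subsetSum M K A J i ℤ.+ + 0                                 ≡⟨ ℤP.+-identityʳ _ ⟩
    subsetSum M K A J i                                         ∎)
    where
    open ≡-Reasoning
    head : ∀ k → χ J (k ↑ˡ K) ℤ.* A (k ↑ˡ K) i ≡ (if lookup J k then A (k ↑ˡ K) i else + 0)
    head k rewrite χ-↑ˡ J k with lookup J k
    ... | true  = ℤP.*-identityˡ (A (k ↑ˡ K) i)
    ... | false = ℤP.*-zeroˡ (A (k ↑ˡ K) i)
    tail : ∀ k → χ J (M ↑ʳ k) ℤ.* A (M ↑ʳ k) i ≡ + 0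
    tail k rewrite χ-↑ʳ J k = ℤP.*-zeroˡ (A (M ↑ʳ k) i)

  toℚ-Σℤ-* : (c : Fin N → ℤ) (i : Fin n) → toℚ (Σℤ (λ j → c j ℤ.* A j i)) ≡ combination (toℚ ∘ c) i
  toℚ-Σℤ-* c i = trans (toℚ-Σℤ (λ j → c j ℤ.* A j i)) (Σℚ.∑-cong {N} (λ j → toℚ-* (c j) (A j i)))

  combination-+-* : (f g : Fin N → ℚ) (r : ℚ) →
                    combination (λ j → f j ℚ.+ r ℚ.* g j) ≗ combination f +ᵖ r *ᵖ combination g
  combination-+-* f g r i = begin
    Σℚ (λ j → (f j ℚ.+ r ℚ.* g j) ℚ.* x j)            ≡⟨ Σℚ.∑-cong {N} (λ j → solve 4 (λ f r g x → (f :+ r :* g) :* x := f :* x :+ r :* (g :* x)) refl (f j) r (g j) (x j)) ⟩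
    Σℚ (λ j → f j ℚ.* x j ℚ.+ r ℚ.* (g j ℚ.* x j))     ≡⟨ Σℚ.∑-distrib-+ {N} _ _ ⟩
    combination f i ℚ.+ Σℚ (λ j → r ℚ.* (g j ℚ.* x j)) ≡⟨ cong (combination f i ℚ.+_) (Σℚ.∑-distribˡ-* {N} r _) ⟩
    combination f i ℚ.+ r ℚ.* combination g i          ∎
    where
    open ≡-Reasoning
    open ℚSolver.+-*-Solver
    x : Fin N → ℚ
    x j = toℚ (A j i)

  NonnegOnTail : (Fin N → ℤ) → Set
  NonnegOnTail y = ∀ k → + 0 ℤ.≤ y (M ↑ʳ k)

  -- The l with expo l = x, for x with the sign pattern of an exponent of F_u.
  index : (Fin N → ℤ) → Fin N → ℕ
  index x j with splitAt M j
  ... | inj₁ _ = ℤ.∣ x j ℤ.+ + 1 ∣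
  ... | inj₂ _ = ℤ.∣ x j ∣

  index-↑ˡ : ∀ x k → index x (k ↑ˡ K) ≡ ℤ.∣ x (k ↑ˡ K) ℤ.+ + 1 ∣
  index-↑ˡ x k rewrite splitAt-↑ˡ M k K = refl

  index-↑ʳ : ∀ x k → index x (M ↑ʳ k) ≡ ℤ.∣ x (M ↑ʳ k) ∣
  index-↑ʳ x k rewrite splitAt-↑ʳ M K k = refl

  index-cong : ∀ {x x′} j → x j ≡ x′ j → index x j ≡ index x′ j
  index-cong j xj≡x′j with splitAt M j
  ... | inj₁ _ = cong (λ t → ℤ.∣ t ℤ.+ + 1 ∣) xj≡x′j
  ... | inj₂ _ = cong ℤ.∣_∣ xj≡x′j

  index-expo : ∀ l → index (expo M K A l) ≗ l
  index-expo l = elimᴹᴷ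
    (λ k → trans (index-↑ˡ _ k) (trans (cong (λ t → ℤ.∣ t ℤ.+ + 1 ∣) (expo-↑ˡ l k)) (∣-[1+m]+1∣≡m (l (k ↑ˡ K)))))
    (λ k → trans (index-↑ʳ _ k) (cong ℤ.∣_∣ (expo-↑ʳ l k)))

  expo-index : ∀ x → (∀ k → x (k ↑ˡ K) ℤ.< + 0) → NonnegOnTail x → expo M K A (index x) ≗ x
  expo-index x x-head x-tail = elimᴹᴷ
    (λ k → trans (expo-↑ˡ (index x) k) (trans (cong -[1+_] (index-↑ˡ x k)) (-[1+∣i+1∣]≡i (x-head k))))
    (λ k → trans (expo-↑ʳ (index x) k) (trans (cong +_ (index-↑ʳ x k)) (ℤP.0≤i⇒+∣i∣≡i (x-tail k))))

  coefAt : (Fin N → ℤ) → ℚ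
  coefAt x = coef M K A (index x)

  coef-cong : ∀ {l l′} → l ≗ l′ → coef M K A l ≡ coef M K A l′
  coef-cong {l} {l′} l≗l′ = ℚP./-cong {{Πfact≢0 (λ k → l (M ↑ʳ k))}} {{Πfact≢0 (λ k → l′ (M ↑ʳ k))}}
    (cong₂ (λ s p → (ℤ.- + 1) ℤ.^ s ℤ.* + p) (Σℕ.∑-cong {M} (λ k → l≗l′ (k ↑ˡ K))) (Πfact-cong (λ k → l≗l′ (k ↑ˡ K))))
    (Πfact-cong (λ k → l≗l′ (M ↑ʳ k)))


  private
    numerator : (Fin N → ℕ) → ℤ
    numerator l = (ℤ.- + 1) ℤ.^ Σℕ (λ k → l (k ↑ˡ K)) ℤ.* + Πfact (λ k → l (k ↑ˡ K))

    denominator : (Fin N → ℕ) → ℕ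
    denominator l = Πfact (λ k → l (M ↑ʳ k))

  coef-step-head : ∀ (l l′ : Fin N → ℕ) k → (∀ j → j ≢ k ↑ˡ K → l j ≡ l′ j) → l (k ↑ˡ K) ≡ suc (l′ (k ↑ˡ K)) →
                   coef M K A l ≡ toℚ -[1+ l′ (k ↑ˡ K) ] ℚ.* coef M K A l′
  coef-step-head l l′ k l≡l′ lk≡1+l′k = begin
    coef M K A l
      ≡⟨ ℚP./-cong {{Πfact≢0 (λ i → l (M ↑ʳ i))}} {{Πfact≢0 (λ i → l′ (M ↑ʳ i))}} numerator-step
           (Πfact-cong (λ i → l≡l′ (M ↑ʳ i) (↑ˡ≢↑ʳ k i ∘ sym))) ⟩
    ((-[1+ m ] ℤ.* numerator l′) ℚ./ denominator l′) {{Πfact≢0 (λ i → l′ (M ↑ʳ i))}}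
      ≡⟨ toℚ-*-/ -[1+ m ] (numerator l′) (denominator l′) {{Πfact≢0 (λ i → l′ (M ↑ʳ i))}} ⟨
    toℚ -[1+ m ] ℚ.* coef M K A l′
      ∎
    where
    open ≡-Reasoning
    m : ℕ
    m = l′ (k ↑ˡ K)
    others : ∀ i → i ≢ k → l (i ↑ˡ K) ≡ l′ (i ↑ˡ K)
    others i i≢k = l≡l′ (i ↑ˡ K) (i≢k ∘ ↑ˡ-injective K i k)
    numerator-step : numerator l ≡ -[1+ m ] ℤ.* numerator l′
    numerator-step = trans
      (cong₂ (λ s p → (ℤ.- + 1) ℤ.^ s ℤ.* + p) (Σℕ.∑-update k 1 others lk≡1+l′k) (Πfact-update k others lk≡1+l′k))
      (trans (cong ((ℤ.- + 1) ℤ.^ suc (Σℕ (λ i → l′ (i ↑ˡ K))) ℤ.*_) (ℤP.pos-* (suc m) _))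
        (solve 3 (λ e s p → (con (ℤ.- + 1) :* e) :* (s :* p) := (:- s) :* (e :* p)) refl
          ((ℤ.- + 1) ℤ.^ Σℕ (λ i → l′ (i ↑ˡ K))) (+ suc m) (+ Πfact (λ i → l′ (i ↑ˡ K)))))
      where open ℤSolver.+-*-Solver

  coef-step-tail : ∀ (l l′ : Fin N → ℕ) k → (∀ j → j ≢ M ↑ʳ k → l j ≡ l′ j) → l′ (M ↑ʳ k) ≡ suc (l (M ↑ʳ k)) →
                   toℚ (+ suc (l (M ↑ʳ k))) ℚ.* coef M K A l′ ≡ coef M K A l
  coef-step-tail l l′ k l≡l′ l′k≡1+lk = begin
    toℚ (+ suc m) ℚ.* coef M K A l′
      ≡⟨ cong (toℚ (+ suc m) ℚ.*_) (ℚP./-cong {{Πfact≢0 (λ i → l′ (M ↑ʳ i))}} {{ℕP.m*n≢0 (suc m) _ {{_}} {{Πfact≢0 (λ i → l (M ↑ʳ i))}}}}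
           (cong₂ (λ s p → (ℤ.- + 1) ℤ.^ s ℤ.* + p) (Σℕ.∑-cong {M} heads) (Πfact-cong heads))
           (Πfact-update k (λ i i≢k → sym (l≡l′ (M ↑ʳ i) (i≢k ∘ ↑ʳ-injective M i k))) l′k≡1+lk)) ⟩
    toℚ (+ suc m) ℚ.* ((numerator l ℚ./ (suc m ℕ.* denominator l)) {{ℕP.m*n≢0 (suc m) _ {{_}} {{Πfact≢0 (λ i → l (M ↑ʳ i))}}}})
      ≡⟨ toℚ-*-/-cancel (numerator l) m (denominator l) {{Πfact≢0 (λ i → l (M ↑ʳ i))}} ⟩
    coef M K A l
      ∎
    where
    open ≡-Reasoning
    m : ℕ
    m = l (M ↑ʳ k)
    heads : ∀ i → l′ (i ↑ˡ K) ≡ l (i ↑ˡ K)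
    heads i = sym (l≡l′ (i ↑ˡ K) (↑ˡ≢↑ʳ i k))

  bump : Fin N → (Fin N → ℤ) → Fin N → ℤ
  bump j x i = x i ℤ.+ δ j i

  bump-self : ∀ j x → bump j x j ≡ x j ℤ.+ + 1
  bump-self j x = cong (λ t → x j ℤ.+ t) (δ-refl j)

  bump-≢ : ∀ {i j} x → i ≢ j → bump j x i ≡ x i
  bump-≢ {i} x i≢j = trans (cong (λ t → x i ℤ.+ t) (δ-≢ (i≢j ∘ sym))) (ℤP.+-identityʳ (x i))

  index-bump-≢ : ∀ {j} x i → i ≢ j → index x i ≡ index (bump j x) i
  index-bump-≢ x i i≢j = index-cong i (sym (bump-≢ x i≢j))

  coefAt-bump-head : ∀ x k → x (k ↑ˡ K) ℤ.+ + 1 ℤ.< + 0 →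
                     toℚ (x (k ↑ˡ K) ℤ.+ + 1) ℚ.* coefAt (bump (k ↑ˡ K) x) ≡ coefAt x
  coefAt-bump-head x k x+1<0 = sym (trans
    (coef-step-head (index x) (index (bump j x)) k (index-bump-≢ x) index-j)
    (cong (λ t → toℚ t ℚ.* coefAt (bump j x)) -[1+index]≡x+1))
    where
    j = k ↑ˡ K
    bump-index : index (bump j x) j ≡ ℤ.∣ (x j ℤ.+ + 1) ℤ.+ + 1 ∣
    bump-index = trans (index-↑ˡ (bump j x) k) (cong (λ t → ℤ.∣ t ℤ.+ + 1 ∣) (bump-self j x))
    index-j : index x j ≡ suc (index (bump j x) j)
    index-j = trans (index-↑ˡ x k) (trans (∣i∣≡1+∣i+1∣ x+1<0) (cong suc (sym bump-index)))
    -[1+index]≡x+1 : -[1+ index (bump j x) j ] ≡ x j ℤ.+ + 1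
    -[1+index]≡x+1 = trans (cong -[1+_] bump-index) (-[1+∣i+1∣]≡i x+1<0)

  coefAt-bump-tail : ∀ x k → + 0 ℤ.≤ x (M ↑ʳ k) →
                     toℚ (x (M ↑ʳ k) ℤ.+ + 1) ℚ.* coefAt (bump (M ↑ʳ k) x) ≡ coefAt x
  coefAt-bump-tail x k 0≤x = trans
    (cong (λ t → toℚ t ℚ.* coefAt (bump j x)) x+1≡1+index)
    (coef-step-tail (index x) (index (bump j x)) k (index-bump-≢ x) bump-index)
    where
    j = M ↑ʳ k
    x+1≡1+index : x j ℤ.+ + 1 ≡ + suc (index x j)
    x+1≡1+index = trans (cong (ℤ._+ + 1) (sym (ℤP.0≤i⇒+∣i∣≡i 0≤x)))
                        (cong +_ (trans (ℕP.+-comm ℤ.∣ x j ∣ 1) (cong suc (sym (index-↑ʳ x k)))))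
    bump-index : index (bump j x) j ≡ suc (index x j)
    bump-index = trans (index-↑ʳ (bump j x) k) (cong ℤ.∣_∣ (trans (bump-self j x) x+1≡1+index))

  InL⇒posPart-negPart-balanced : ∀ l → InL M K A l →
    ∀ i → Σℤ (λ j → + posPart {N} (l j) ℤ.* A j i) ≡ Σℤ (λ j → + negPart {N} (l j) ℤ.* A j i)
  InL⇒posPart-negPart-balanced l l∈L i = begin
    Σℤ (λ j → + l⁺ j ℤ.* A j i)                            ≡⟨ Σℤ.∑-cong {N} (λ j → trans (cong (ℤ._* A j i) (+posPart≡i+negPart {N} (l j))) (ℤP.*-distribʳ-+ (A j i) (l j) (+ l⁻ j))) ⟩
    Σℤ (λ j → l j ℤ.* A j i ℤ.+ + l⁻ j ℤ.* A j i)           ≡⟨ Σℤ.∑-distrib-+ {N} _ _ ⟩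
    Σℤ (λ j → l j ℤ.* A j i) ℤ.+ Σℤ (λ j → + l⁻ j ℤ.* A j i) ≡⟨ cong (ℤ._+ Σℤ (λ j → + l⁻ j ℤ.* A j i)) (l∈L i) ⟩
    + 0 ℤ.+ Σℤ (λ j → + l⁻ j ℤ.* A j i)                    ≡⟨ ℤP.+-identityˡ _ ⟩
    Σℤ (λ j → + l⁻ j ℤ.* A j i)                            ∎
    where
    open ≡-Reasoning
    l⁺ l⁻ : Fin N → ℕ
    l⁺ j = posPart {N} (l j)
    l⁻ j = negPart {N} (l j)

module Support {n : ℕ} (M K : ℕ) (A : Fin (M + K) → Lat n) (u : Lat n) where
  open Configuration M K A

  Represents : (Fin N → ℤ) → Set
  Represents y = ∀ i → Σℤ (λ j → y j ℤ.* A j i) ≡ u i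

  represents-resp : ∀ {y y′} → y ≗ y′ → Represents y → Represents y′
  represents-resp y≗y′ rep i = trans (Σℤ.∑-cong {N} (λ j → cong (ℤ._* A j i) (sym (y≗y′ j)))) (rep i)

  embed-u≗combination : ∀ {y} → Represents y → embed u ≗ combination (toℚ ∘ y)
  embed-u≗combination {y} rep i = trans (cong toℚ (sym (rep i))) (toℚ-Σℤ-* y i)

  Admissible : (Fin N → ℤ) → Set
  Admissible e = Σ (Fin N → ℕ) λ l → InE M K A l × (∀ j → expo M K A l j ≡ e j) × SumCond M K A u l

  admissible⇒represents : ∀ {e} → Admissible e → Represents e
  admissible⇒represents (_ , _ , expo≗e , sum) = represents-resp expo≗e sum

  admissible⇒nonnegOnTail : ∀ {e} → Admissible e → NonnegOnTail e
  admissible⇒nonnegOnTail (l , _ , expo≗e , _) k =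
    subst (+ 0 ℤ.≤_) (trans (sym (expo-↑ʳ l k)) (expo≗e (M ↑ʳ k))) (ℤ.+≤+ ℕ.z≤n)

  _⊕_ : (Fin N → ℤ) → (Fin N → ℕ) → Fin N → ℤ
  (x ⊕ q) j = x j ℤ.+ + q j

  Supported : (Fin N → ℕ) → (Fin N → ℤ) → Set
  Supported q x = Represents (x ⊕ q) × NonnegOnTail x

  nonnegOnTail-⊕ : ∀ {x} → NonnegOnTail x → ∀ {q} → NonnegOnTail (x ⊕ q)
  nonnegOnTail-⊕ x-tail k = ℤP.+-mono-≤ (x-tail k) (ℤ.+≤+ ℕ.z≤n)

  supported-resp : ∀ {q q′} → q ≗ q′ → ∀ {x} → Supported q x → Supported q′ x
  supported-resp q≗q′ {x} (rep , x-tail) = represents-resp (λ j → cong (λ t → x j ℤ.+ + t) (q≗q′ j)) rep , x-tail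

  ⊕-bump : ∀ x q j → x ⊕ (λ i → q i ℕ.+ δℕ j i) ≗ bump j x ⊕ q
  ⊕-bump x q j i = begin
    x i ℤ.+ + (q i ℕ.+ δℕ j i)      ≡⟨ cong (λ t → x i ℤ.+ t) (ℤP.pos-+ (q i) (δℕ j i)) ⟩
    x i ℤ.+ (+ q i ℤ.+ + δℕ j i)    ≡⟨ cong (λ t → x i ℤ.+ (+ q i ℤ.+ t)) (+δℕ≡δ j i) ⟩
    x i ℤ.+ (+ q i ℤ.+ δ j i)       ≡⟨ solve 3 (λ x q d → x :+ (q :+ d) := (x :+ d) :+ q) refl (x i) (+ q i) (δ j i) ⟩
    (x i ℤ.+ δ j i) ℤ.+ + q i       ∎
    where
      open ≡-Reasoning
      open ℤSolver.+-*-Solver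

  supported-bump : ∀ {q x} j → Supported (λ i → q i ℕ.+ δℕ j i) x → Supported q (bump j x)
  supported-bump {q} {x} j (rep , x-tail) =
    represents-resp (⊕-bump x q j) rep , λ k → ℤP.+-mono-≤ (x-tail k) (0≤δ j (M ↑ʳ k))

  supported-unbump : ∀ {q x} j → x j ℤ.+ + 1 ≢ + 0 → Supported q (bump j x) → Supported (λ i → q i ℕ.+ δℕ j i) x
  supported-unbump {q} {x} j x+1≢0 (rep , bump-tail) = represents-resp (sym ∘ ⊕-bump x q j) rep , x-tail
    where
    x-tail : NonnegOnTail x
    x-tail k with j Fin.≟ M ↑ʳ k
    ... | yes refl = 0≤i+1≢0⇒0≤i (subst (+ 0 ℤ.≤_) (bump-self j x) (bump-tail k)) x+1≢0
    ... | no  j≢k  = subst (+ 0 ℤ.≤_) (bump-≢ x (j≢k ∘ sym)) (bump-tail k)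

  Fu-extensional : ∀ {F} → IsFu M K A u F → Extensional F
  Fu-extensional {F} isFu {x} {x′} x≗x′ = ≡-byCases {Admissible x}
    (λ (l , l∈E , expo≗x , sum) → trans (proj₁ (isFu x) l l∈E expo≗x sum)
                                       (sym (proj₁ (isFu x′) l l∈E (λ j → trans (expo≗x j) (x≗x′ j)) sum)))
    (λ ¬adm → trans (proj₂ (isFu x) ¬adm) (sym (proj₂ (isFu x′)
      λ (l , l∈E , expo≗x′ , sum) → ¬adm (l , l∈E , (λ j → trans (expo≗x′ j) (sym (x≗x′ j))) , sum))))

  supported-swap : ∀ {p p′} → (∀ i → Σℤ (λ j → + p j ℤ.* A j i) ≡ Σℤ (λ j → + p′ j ℤ.* A j i)) →
                   ∀ {x} → Supported p x → Supported p′ x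
  supported-swap {p} {p′} balanced {x} (rep , x-tail) = rep′ , x-tail
    where
    split : ∀ i q → Σℤ (λ j → (x j ℤ.+ + q j) ℤ.* A j i) ≡ Σℤ (λ j → x j ℤ.* A j i) ℤ.+ Σℤ (λ j → + q j ℤ.* A j i)
    split i q = trans (Σℤ.∑-cong {N} (λ j → ℤP.*-distribʳ-+ (A j i) (x j) (+ q j))) (Σℤ.∑-distrib-+ {N} _ _)
    rep′ : Represents (x ⊕ p′)
    rep′ i = begin
      Σℤ (λ j → (x j ℤ.+ + p′ j) ℤ.* A j i)                   ≡⟨ split i p′ ⟩
      Σℤ (λ j → x j ℤ.* A j i) ℤ.+ Σℤ (λ j → + p′ j ℤ.* A j i) ≡⟨ cong (λ t → Σℤ (λ j → x j ℤ.* A j i) ℤ.+ t) (balanced i) ⟨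
      Σℤ (λ j → x j ℤ.* A j i) ℤ.+ Σℤ (λ j → + p j ℤ.* A j i)  ≡⟨ split i p ⟨
      Σℤ (λ j → (x j ℤ.+ + p j) ℤ.* A j i)                    ≡⟨ rep i ⟩
      u i                                                    ∎
      where open ≡-Reasoning

  euler-annihilates : ∀ {F} → IsFu M K A u F → ∀ i → Annihilates (euler M K A u i) F
  euler-annihilates {F} isFu i e = begin
    Σℚ (λ j → toℚ (A j i) ℚ.* mulΛ j (∂ j F) e) ℚ.- toℚ (u i) ℚ.* F e  ≡⟨ cong (ℚ._- toℚ (u i) ℚ.* F e) weighted-sum ⟩
    F e ℚ.* combination (toℚ ∘ e) i ℚ.- toℚ (u i) ℚ.* F e            ≡⟨ ≡-byCases {Represents e} on-support off-support ⟩
    0ℚ                                                              ∎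
    where
    open ≡-Reasoning
    open ℚSolver.+-*-Solver
    weighted-sum : Σℚ (λ j → toℚ (A j i) ℚ.* mulΛ j (∂ j F) e) ≡ F e ℚ.* combination (toℚ ∘ e) i
    weighted-sum = trans
      (Σℚ.∑-cong {N} (λ j → trans (cong (toℚ (A j i) ℚ.*_) (mulΛ-∂ (Fu-extensional isFu) j e))
        (solve 3 (λ a x f → a :* (x :* f) := f :* (x :* a)) refl (toℚ (A j i)) (toℚ (e j)) (F e))))
      (Σℚ.∑-distribˡ-* {N} (F e) _)
    on-support : Represents e → F e ℚ.* combination (toℚ ∘ e) i ℚ.- toℚ (u i) ℚ.* F e ≡ 0ℚ
    on-support rep = trans (cong (λ t → F e ℚ.* t ℚ.- toℚ (u i) ℚ.* F e) (sym (embed-u≗combination {e} rep i)))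
      (solve 2 (λ f t → f :* t :- t :* f := con 0ℚ) refl (F e) (toℚ (u i)))
    off-support : ¬ Represents e → F e ℚ.* combination (toℚ ∘ e) i ℚ.- toℚ (u i) ℚ.* F e ≡ 0ℚ
    off-support ¬rep = trans (cong (λ f → f ℚ.* combination (toℚ ∘ e) i ℚ.- toℚ (u i) ℚ.* f) (proj₂ (isFu e) (¬rep ∘ admissible⇒represents)))
      (solve 2 (λ c t → con 0ℚ :* c :- t :* con 0ℚ := con 0ℚ) refl (combination (toℚ ∘ e) i) (toℚ (u i)))

  module _ (u∈Mβ : InMβ M K A u) where

    w·u≡0 : ∀ w → Supporting M K A w → w · embed (β M K A) ≡ 0ℚ → w · embed u ≡ 0ℚ
    w·u≡0 w sup w⊥β = ℚP.neg-injective (begin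
      ℚ.- (w · embed u)                ≡⟨ ·-neg w (embed u) ⟨
      w · (λ i → ℚ.- toℚ (u i))        ≡⟨ ·-congˡ w (λ i → toℚ-neg (u i)) ⟨
      w · embed (λ i → ℤ.- u i)        ≡⟨ proj₂ (proj₁ (proj₁ u∈Mβ)) w sup w⊥β ⟩
      0ℚ                               ∎)
      where open ≡-Reasoning

    tail∈σβ : ∀ y → Represents y → NonnegOnTail y → ∀ k → y (M ↑ʳ k) ≢ + 0 → σβ M K A (a (M ↑ʳ k))
    tail∈σβ y rep y-tail k yk≢0 = a∈C (M ↑ʳ k) , λ w sup w⊥β →
      p*q≡0⇒q≡0 (yk≢0 ∘ toℚ-injective)
        (Σℚ≡0⇒≡0 (term w) (0≤term w sup w⊥β)
          (trans (sym (·-combination w (toℚ ∘ y))) (trans (sym (·-congˡ w (embed-u≗combination {y} rep))) (w·u≡0 w sup w⊥β)))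
          (M ↑ʳ k))
      where
      term : Point n → Fin N → ℚ
      term w j = toℚ (y j) ℚ.* (w · a j)
      0≤term : ∀ w → Supporting M K A w → w · embed (β M K A) ≡ 0ℚ → ∀ j → 0ℚ ℚ.≤ term w j
      0≤term w sup w⊥β = elimᴹᴷ
        (λ k → ℚP.≤-reflexive (sym (trans (cong (toℚ (y (k ↑ˡ K)) ℚ.*_) (proj₂ (head∈σβ k) w sup w⊥β)) (ℚP.*-zeroʳ (toℚ (y (k ↑ˡ K)))))))
        (λ k → 0≤-* (toℚ-mono-≤ (y-tail k)) (supporting⇒0≤·a w sup (M ↑ʳ k)))

    module _ (minimal : MinimalFor M K A) where

      negatives : (Fin N → ℤ) → Subset M
      negatives y = tabulate (λ k → does (y (k ↑ˡ K) ℤP.<? + 0))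

      χ-negatives-↑ˡ : ∀ y k → χ (negatives y) (k ↑ˡ K) ≡ (if does (y (k ↑ˡ K) ℤP.<? + 0) then + 1 else + 0)
      χ-negatives-↑ˡ y k = trans (χ-↑ˡ (negatives y) k) (cong (λ b → if b then + 1 else + 0) (Vec.lookup∘tabulate _ k))

      negatives≢⊤ : ∀ y k → ¬ y (k ↑ˡ K) ℤ.< + 0 → negatives y ≢ Subset.⊤
      negatives≢⊤ y k y≮0 J≡⊤ = contradiction true≡false λ ()
        where
        open ≡-Reasoning
        true≡false : true ≡ false
        true≡false = begin
          true                          ≡⟨ Vec.lookup-replicate k true ⟨
          lookup Subset.⊤ k             ≡⟨ cong (λ J → lookup J k) J≡⊤ ⟨
          lookup (negatives y) k        ≡⟨ Vec.lookup∘tabulate _ k ⟩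
          does (y (k ↑ˡ K) ℤP.<? + 0)    ≡⟨ dec-false (y (k ↑ˡ K) ℤP.<? + 0) y≮0 ⟩
          false                         ∎

      subsetSum-negatives∈relint : ∀ y → Represents y → NonnegOnTail y →
        (r : ℚ) → 0ℚ ℚ.< r → (∀ j → 0ℚ ℚ.≤ 1ℚ ℚ.+ r ℚ.* toℚ (y j)) →
        InRelInt M K A (σβ M K A) (embed (subsetSum M K A (negatives y)))
      subsetSum-negatives∈relint y rep y-tail r 0<r 0≤1+ry =
        relInt-resp σβ-isConvexCone decomposition
          (relInt-shift σβ-isConvexCone 0<r (proj₁ u∈Mβ) (combination∈σβ weight 0≤weight weight≡0⊎∈σβ))
        where
        J : Subset M
        J = negatives y
        weight : Fin N → ℚ
        weight j = toℚ (χ J j) ℚ.+ r ℚ.* toℚ (y j)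

        decomposition : r *ᵖ embed (λ i → ℤ.- u i) +ᵖ combination weight ≗ embed (subsetSum M K A J)
        decomposition i = begin
          r ℚ.* toℚ (ℤ.- u i) ℚ.+ combination weight i
            ≡⟨ cong₂ ℚ._+_ (cong (r ℚ.*_) (toℚ-neg (u i))) (combination-+-* (toℚ ∘ χ J) (toℚ ∘ y) r i) ⟩
          r ℚ.* ℚ.- toℚ (u i) ℚ.+ (combination (toℚ ∘ χ J) i ℚ.+ r ℚ.* combination (toℚ ∘ y) i)
            ≡⟨ cong (λ t → r ℚ.* ℚ.- t ℚ.+ (combination (toℚ ∘ χ J) i ℚ.+ r ℚ.* combination (toℚ ∘ y) i)) (embed-u≗combination {y} rep i) ⟩
          r ℚ.* ℚ.- combination (toℚ ∘ y) i ℚ.+ (combination (toℚ ∘ χ J) i ℚ.+ r ℚ.* combination (toℚ ∘ y) i)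
            ≡⟨ solve 3 (λ r y x → r :* (:- y) :+ (x :+ r :* y) := x) refl r (combination (toℚ ∘ y) i) (combination (toℚ ∘ χ J) i) ⟩
          combination (toℚ ∘ χ J) i
            ≡⟨ toℚ-Σℤ-* (χ J) i ⟨
          toℚ (Σℤ (λ j → χ J j ℤ.* A j i))
            ≡⟨ cong toℚ (subsetSum≡Σχ J i) ⟨
          embed (subsetSum M K A J) i
            ∎
          where
            open ≡-Reasoning
            open ℚSolver.+-*-Solver

        0≤r*y : ∀ {j} → + 0 ℤ.≤ y j → 0ℚ ℚ.≤ r ℚ.* toℚ (y j)
        0≤r*y 0≤y = 0≤-* (ℚP.<⇒≤ 0<r) (toℚ-mono-≤ 0≤y)

        0≤weight : ∀ j → 0ℚ ℚ.≤ weight j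
        0≤weight = elimᴹᴷ head tail
          where
          head : ∀ k → 0ℚ ℚ.≤ weight (k ↑ˡ K)
          head k rewrite χ-negatives-↑ˡ y k with y (k ↑ˡ K) ℤP.<? + 0
          ... | yes _    = 0≤1+ry (k ↑ˡ K)
          ... | no  y≮0 = ℚP.+-mono-≤ ℚP.≤-refl (0≤r*y (ℤP.≮⇒≥ y≮0))
          tail : ∀ k → 0ℚ ℚ.≤ weight (M ↑ʳ k)
          tail k rewrite χ-↑ʳ J k = ℚP.+-mono-≤ ℚP.≤-refl (0≤r*y (y-tail k))

        weight≡0⊎∈σβ : ∀ j → weight j ≡ 0ℚ ⊎ σβ M K A (a j)
        weight≡0⊎∈σβ = elimᴹᴷ (inj₂ ∘ head∈σβ) tail
          where
          tail : ∀ k → weight (M ↑ʳ k) ≡ 0ℚ ⊎ σβ M K A (a (M ↑ʳ k))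
          tail k with y (M ↑ʳ k) ℤ.≟ + 0
          ... | yes yk≡0 = inj₁ (trans (cong₂ (λ c z → toℚ c ℚ.+ r ℚ.* toℚ z) (χ-↑ʳ J k) yk≡0) (trans (ℚP.+-identityˡ (r ℚ.* 0ℚ)) (ℚP.*-zeroʳ r)))
          ... | no  yk≢0 = inj₂ (tail∈σβ y rep y-tail k yk≢0)

      head-negative : ∀ y → Represents y → NonnegOnTail y → ∀ k → y (k ↑ˡ K) ℤ.< + 0
      head-negative y rep y-tail k = decidable-stable (y (k ↑ˡ K) ℤP.<? + 0) λ y≮0 →
        minimal (negatives y) (negatives≢⊤ y k y≮0) (subsetSum-negatives∈relint y rep y-tail r 0<r 0≤1+ry)
        where
        r : ℚ
        r = proj₁ (small-scale y)
        0<r : 0ℚ ℚ.< r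
        0<r = proj₁ (proj₂ (small-scale y))
        0≤1+ry : ∀ j → 0ℚ ℚ.≤ 1ℚ ℚ.+ r ℚ.* toℚ (y j)
        0≤1+ry = proj₂ (proj₂ (small-scale y))

      represents⇒admissible : ∀ e → Represents e → NonnegOnTail e → Admissible e
      represents⇒admissible e rep e-tail =
        index e , index∈E , expo≗e , represents-resp (sym ∘ expo≗e) rep
        where
        expo≗e : expo M K A (index e) ≗ e
        expo≗e = expo-index e (head-negative e rep e-tail) e-tail
        index∈E : InE M K A (index e)
        index∈E = elimᴹᴷ (λ k ∉σβ → contradiction (head∈σβ k) ∉σβ) tail
          where
          tail : ∀ k → ¬ σβ M K A (a (M ↑ʳ k)) → index e (M ↑ʳ k) ≡ 0
          tail k ∉σβ with e (M ↑ʳ k) ℤ.≟ + 0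
          ... | yes ek≡0 = trans (index-↑ʳ e k) (cong ℤ.∣_∣ ek≡0)
          ... | no  ek≢0 = contradiction (tail∈σβ e rep e-tail k ek≢0) ∉σβ

      -- G has the coefficients of ∂^q F_u: at Λ^x, that of the monomial Λ^x if x + q is an exponent
      -- of F_u and no Λ_j with j > M is differentiated past its power, and 0 otherwise.
      IsDerivative : (Fin N → ℕ) → Series N → Set
      IsDerivative q G = ∀ x → (Supported q x → G x ≡ coefAt x) × (¬ Supported q x → G x ≡ 0ℚ)

      isDerivative-resp : ∀ {q q′ G} → q ≗ q′ → IsDerivative q G → IsDerivative q′ G
      isDerivative-resp q≗q′ G-deriv x =
        proj₁ (G-deriv x) ∘ supported-resp (sym ∘ q≗q′) {x} , λ ¬supp → proj₂ (G-deriv x) (¬supp ∘ supported-resp q≗q′ {x})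

      isDerivative-Fu : ∀ {F} → IsFu M K A u F → IsDerivative (λ _ → 0) F
      isDerivative-Fu {F} isFu x = on-support , off-support
        where
        x⊕0≗x : x ⊕ (λ _ → 0) ≗ x
        x⊕0≗x j = ℤP.+-identityʳ (x j)
        on-support : Supported (λ _ → 0) x → F x ≡ coefAt x
        on-support (rep , x-tail) = coefficient (represents⇒admissible x (represents-resp x⊕0≗x rep) x-tail)
          where
          coefficient : Admissible x → F x ≡ coefAt x
          coefficient (l , l∈E , expo≗x , sum) = trans (proj₁ (isFu x) l l∈E expo≗x sum)
            (coef-cong (λ j → trans (sym (index-expo l j)) (index-cong j (expo≗x j))))
        off-support : ¬ Supported (λ _ → 0) x → F x ≡ 0ℚ
        off-support ¬supp = proj₂ (isFu x) λ adm →
          ¬supp (represents-resp (sym ∘ x⊕0≗x) (admissible⇒represents adm) , admissible⇒nonnegOnTail adm)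

      coefAt-bump : ∀ {q x} j → Supported (λ i → q i ℕ.+ δℕ j i) x →
                    toℚ (x j ℤ.+ + 1) ℚ.* coefAt (bump j x) ≡ coefAt x
      coefAt-bump {q} {x} = elimᴹᴷ {P = Step} head tail
        where
        Step : Fin N → Set
        Step j = Supported (λ i → q i ℕ.+ δℕ j i) x → toℚ (x j ℤ.+ + 1) ℚ.* coefAt (bump j x) ≡ coefAt x
        head : ∀ k → Step (k ↑ˡ K)
        head k (rep , x-tail) = coefAt-bump-head x k (i+n<0⇒i<0 (begin-strict
          x j ℤ.+ + 1 ℤ.+ + q j          ≡⟨ cong (ℤ._+ + q j) (bump-self j x) ⟨
          bump j x j ℤ.+ + q j           ≡⟨ ⊕-bump x q j j ⟨
          (x ⊕ (λ i → q i ℕ.+ δℕ j i)) j  <⟨ head-negative (x ⊕ (λ i → q i ℕ.+ δℕ j i)) rep (nonnegOnTail-⊕ {x} x-tail {λ i → q i ℕ.+ δℕ j i}) k ⟩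
          + 0                            ∎))
          where
          open ℤP.≤-Reasoning
          j = k ↑ˡ K
        tail : ∀ k → Step (M ↑ʳ k)
        tail k (_ , x-tail) = coefAt-bump-tail x k (x-tail k)

      isDerivative-∂ : ∀ {q G} j → IsDerivative q G → IsDerivative (λ i → q i ℕ.+ δℕ j i) (∂ j G)
      isDerivative-∂ {q} {G} j G-deriv x = on-support , off-support
        where
        on-support : Supported (λ i → q i ℕ.+ δℕ j i) x → ∂ j G x ≡ coefAt x
        on-support supp = trans (cong (toℚ (x j ℤ.+ + 1) ℚ.*_) (proj₁ (G-deriv (bump j x)) (supported-bump {q} {x} j supp)))
                                (coefAt-bump {q} {x} j supp)
        off-support : ¬ Supported (λ i → q i ℕ.+ δℕ j i) x → ∂ j G x ≡ 0ℚ
        off-support ¬supp with x j ℤ.+ + 1 ℤ.≟ + 0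
        ... | yes x+1≡0 = trans (cong (λ t → toℚ t ℚ.* G (bump j x)) x+1≡0) (ℚP.*-zeroˡ (G (bump j x)))
        ... | no  x+1≢0 = trans (cong (toℚ (x j ℤ.+ + 1) ℚ.*_) (proj₂ (G-deriv (bump j x)) (¬supp ∘ supported-unbump {q} {x} j x+1≢0)))
                                (ℚP.*-zeroʳ (toℚ (x j ℤ.+ + 1)))

      isDerivative-∂^ : ∀ {q G} j m → IsDerivative q G → IsDerivative (λ i → q i ℕ.+ m ℕ.* δℕ j i) (∂^ j m G)
      isDerivative-∂^ {q} j zero    G-deriv = isDerivative-resp (λ i → sym (ℕP.+-identityʳ (q i))) G-deriv
      isDerivative-∂^ {q} j (suc m) G-deriv = isDerivative-resp
        (λ i → trans (ℕP.+-assoc (q i) _ _) (cong (q i ℕ.+_) (ℕP.+-comm (m ℕ.* δℕ j i) (δℕ j i))))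
        (isDerivative-∂ j (isDerivative-∂^ j m G-deriv))

      isDerivative-foldr : ∀ {q G m} (k : Fin N → ℕ) (f : Fin m → Fin N) → IsDerivative q G →
        IsDerivative (λ i → q i ℕ.+ Σℕ (λ t → k (f t) ℕ.* δℕ (f t) i)) (foldr (λ j H → ∂^ j (k j) H) G (List.tabulate f))
      isDerivative-foldr {q} {m = zero}  k f G-deriv = isDerivative-resp (λ i → sym (ℕP.+-identityʳ (q i))) G-deriv
      isDerivative-foldr {q} {m = suc m} k f G-deriv = isDerivative-resp
        (λ i → trans (ℕP.+-assoc (q i) _ _) (cong (q i ℕ.+_) (ℕP.+-comm (Σℕ (λ t → k (f (suc t)) ℕ.* δℕ (f (suc t)) i)) _)))
        (isDerivative-∂^ (f zero) (k (f zero)) (isDerivative-foldr k (f ∘ suc) G-deriv))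

      isDerivative-∂multi : ∀ {F} → IsFu M K A u F → ∀ p → IsDerivative p (∂multi p F)
      isDerivative-∂multi isFu p = isDerivative-resp Σ≗p (isDerivative-foldr p (λ t → t) (isDerivative-Fu isFu))
        where
        Σ≗p : ∀ i → Σℕ (λ t → p t ℕ.* δℕ t i) ≡ p i
        Σ≗p i = trans (Σℕ.∑-single i (λ t t≢i → trans (cong (λ d → p t ℕ.* ℤ.∣ d ∣) (δ-≢ t≢i)) (ℕP.*-zeroʳ (p t))))
                      (trans (cong (λ d → p i ℕ.* ℤ.∣ d ∣) (δ-refl i)) (ℕP.*-identityʳ (p i)))

      box-annihilates : ∀ {F} → IsFu M K A u F → ∀ l → InL M K A l → Annihilates (box l) F
      box-annihilates {F} isFu l l∈L x = ≡-byCases {Supported l⁺ x}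
        (λ supp → trans (cong₂ ℚ._-_ (proj₁ (D⁺ x) supp) (proj₁ (D⁻ x) (supported-swap {l⁺} {l⁻} balanced {x} supp)))
                        (ℚP.+-inverseʳ (coefAt x)))
        (λ ¬supp → trans (cong₂ ℚ._-_ (proj₂ (D⁺ x) ¬supp) (proj₂ (D⁻ x) (¬supp ∘ supported-swap {l⁻} {l⁺} (sym ∘ balanced) {x})))
                         (ℚP.+-inverseʳ 0ℚ))
        where
        l⁺ l⁻ : Fin N → ℕ
        l⁺ j = posPart {N} (l j)
        l⁻ j = negPart {N} (l j)
        D⁺ : IsDerivative l⁺ (∂multi l⁺ F)
        D⁺ = isDerivative-∂multi isFu l⁺
        D⁻ : IsDerivative l⁻ (∂multi l⁻ F)
        D⁻ = isDerivative-∂multi isFu l⁻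
        balanced : ∀ i → Σℤ (λ j → + l⁺ j ℤ.* A j i) ≡ Σℤ (λ j → + l⁻ j ℤ.* A j i)
        balanced = InL⇒posPart-negPart-balanced l l∈L

corollary2p8 : (n′ M K : ℕ) → 1 ≤ M →
    (A : Fin (M + K) → Lat (suc n′)) →
    (∀ j → A j (fromℕ n′) ≡ + 1) →
    MinimalFor M K A →
    (u : Lat (suc n′)) → InMβ M K A u →
    (F : Series (M + K)) → IsFu M K A u F →
    ((l : Fin (M + K) → ℤ) → InL M K A l → Annihilates (box l) F) ×
    ((i : Fin (suc n′)) → Annihilates (euler M K A u i) F)
corollary2p8 n′ M K _ A _ minimal u u∈Mβ F isFu =
  box-annihilates u∈Mβ minimal isFu , euler-annihilates isFu
  where open Support M K A u
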